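{- (i) For every $n\ge 1$, $|\mathcal{DRS}_n(321)|=C_n$, the $n$th Catalan number $C_n=\frac{1}{n+1}\binom{2n}{n}$. (ii) $|\mathcal{DRS}_4(123)|=5$, $|\mathcal{DRS}_5(123)|=3$, and $|\mathcal{DRS}_n(123)|=2$ for all $n\ge 6$.
   Context: For $\sigma\in\mathfrak{S}_n$, a double descent is an index $i$ with $\sigma_i>\sigma_{i+1}>\sigma_{i+2}$. The permutation $\sigma$ is simsun if for every $k$, the subword of $\sigma$ consisting of the letters in $\{1,\dots,k\}$ (in the order they appear in $\sigma$) has no double descent. For $\omega\in\mathfrak{S}_t$, $\sigma$ contains an $\omega$-pattern if there are indices $i_1<\cdots<i_t$ with $\sigma_{i_j}<\sigma_{i_k}$ iff $\omega_j<\omega_k$; otherwise $\sigma$ avoids $\omega$. $\mathcal{DRS}_n(\omega)$ is the set of $\sigma\in\mathfrak{S}_n$ such that $\sigma$ is $\omega$-avoiding and simsun and $\sigma^{ -1}$ is simsun. -}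

module Defs where

open import Data.Nat using (ℕ; zero; suc; _+_; _*_; _<_; _<?_)
open import Data.Nat.DivMod using (_/_)
open import Data.Nat.Combinatorics using (_C_)
open import Data.Fin using (Fin; toℕ) renaming (zero to fzero; suc to fsuc)
open import Data.Fin using () renaming (_<_ to _<ᶠ_)
open import Data.Vec using (Vec; lookup; toList; []; _∷_)
open import Data.List using (List; []; _∷_; map; filter; length)
open import Data.List.Membership.Propositional using (_∈_)
open import Data.List.Relation.Unary.Unique.Propositional using (Unique)
open import Data.Product using (Σ; ∃; _×_)
open import Data.Empty using (⊥)
open import Data.Unit using (⊤)
open import Relation.Nullary using (¬_)
open import Relation.Binary.PropositionalEquality using (_≡_; _≢_)
open import Function.Bundles using (_⇔_)

-- A permutation of [n] in one-line notation, values shifted to 0..n-1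
-- (order patterns and simsun-ness are invariant under this shift).
IsPerm : ∀ {n} → Vec (Fin n) n → Set
IsPerm {n} σ = ∀ (i j : Fin n) → lookup σ i ≡ lookup σ j → i ≡ j

IsInverse : ∀ {n} → Vec (Fin n) n → Vec (Fin n) n → Set
IsInverse {n} τ σ = ∀ (i : Fin n) → lookup τ (lookup σ i) ≡ i

NoDoubleDescent : List ℕ → Set
NoDoubleDescent (a ∷ b ∷ c ∷ rest) =
  ¬ (b < a × c < b) × NoDoubleDescent (b ∷ c ∷ rest)
NoDoubleDescent _ = ⊤

-- subword of the letters with value < k (i.e. letters 1..k in 1-based terms)
restrict : ℕ → List ℕ → List ℕ
restrict k = filter (λ x → x <? k)

Simsun : ∀ {n} → Vec (Fin n) n → Set
Simsun σ = ∀ (k : ℕ) → NoDoubleDescent (restrict k (map toℕ (toList σ)))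

StrictIncr : ∀ {t n} → (Fin t → Fin n) → Set
StrictIncr {t} f = ∀ (j k : Fin t) → j <ᶠ k → f j <ᶠ f k

Contains : ∀ {t n} → Vec (Fin n) n → Vec (Fin t) t → Set
Contains {t} {n} σ ω = Σ (Fin t → Fin n) λ idx → StrictIncr idx ×
  (∀ (j k : Fin t) → (lookup σ (idx j) <ᶠ lookup σ (idx k)) ⇔ (lookup ω j <ᶠ lookup ω k))

Avoids : ∀ {t n} → Vec (Fin n) n → Vec (Fin t) t → Set
Avoids σ ω = ¬ Contains σ ω

DRS : ∀ {t} (n : ℕ) → Vec (Fin t) t → Vec (Fin n) n → Set
DRS n ω σ = IsPerm σ × Avoids σ ω × Simsun σ ×
  Σ (Vec (Fin n) n) (λ τ → IsInverse τ σ × Simsun τ)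

HasCard : ∀ {A : Set} → (A → Set) → ℕ → Set
HasCard {A} P k = Σ (List A) λ xs → Unique xs × (∀ x → (x ∈ xs) ⇔ P x) × length xs ≡ k

catalan : ℕ → ℕ
catalan n = ((2 * n) C n) / suc n

p321 : Vec (Fin 3) 3
p321 = fsuc (fsuc fzero) ∷ fsuc fzero ∷ fzero ∷ []

p123 : Vec (Fin 3) 3
p123 = fzero ∷ fsuc fzero ∷ fsuc (fsuc fzero) ∷ []

module Submission where

-- Everything is organised around `insertMax p σ`, which inserts the new maximum value n at
-- position p of a permutation σ of [n]; every permutation of [n+1] arises from exactly one
-- pair (p, σ).
--
-- A 321-avoider has no 321 subsequence, hence no double descent in any of its
-- restrictions, and its inverse is again 321-avoiding; so DRS_n(321) is the set of
-- 321-avoiders.  These are enumerated by the classical generating tree: label a 321-avoider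
-- by its number k of active sites (insertion positions keeping it 321-avoiding); a node
-- labelled k has children labelled k+1, 2, 3, …, k.
--
-- DRS(123) is closed under deleting the maximum, so DRS_n(123) is computed from
-- DRS_{n-1}(123) by trying every insertion and deciding membership; this settles n = 4, 5, 6
-- by evaluation.  For n ≥ 6 an induction shows that the only members are two explicit
-- families A and B (each step inserts the maximum at position 0 or 1), and conversely that
-- both families, together with their inverses, satisfy all the conditions.

open import Defs
open import Data.Nat
  using (ℕ; zero; suc; z≤n; s≤s; _+_; _*_; _∸_; _<_; _≤_; _<?_; _≤?_)
import Data.Nat.Properties as ℕP
open import Data.Fin
  using (Fin; toℕ; fromℕ; fromℕ<; inject₁; lower₁; punchIn; punchOut; #_)
  renaming (zero to fzero; suc to fsuc; _<_ to _<ᶠ_)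
import Data.Fin.Properties as FP
open import Data.Vec as V using (Vec; []; _∷_; lookup; tabulate; insertAt; toList; _∷ʳ_)
import Data.Vec.Properties as VP
open import Data.List using (List; []; _∷_; map; filter; _++_; length; allFin)
open import Data.Nat.ListAction using (sum)
open import Data.Nat.DivMod using (_/_; m*n/n≡m)
open import Data.Nat.Combinatorics using (_C_; nCk+nC[k+1]≡[n+1]C[k+1]; nCk≡nC[n∸k]; nC1≡n)
open import Data.Nat.Combinatorics.Specification using (k>n⇒nCk≡0)
open import Data.Nat.Tactic.RingSolver using (solve-∀)
open import Data.Nat.ListAction.Properties using (sum-++)
import Data.List.Properties as LP
open import Data.List.Relation.Unary.All as All using (All; []; _∷_)
import Data.List.Relation.Unary.All.Properties as AllP
open import Data.List.Relation.Unary.Any using (here; there)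
open import Data.List.Membership.Propositional using (_∈_)
open import Data.List.Membership.Propositional.Properties
  using (∈-map⁺; ∈-map⁻; ∈-++⁺ˡ; ∈-++⁺ʳ; ∈-++⁻; ∈-filter⁺; ∈-filter⁻; ∈-allFin)
open import Data.List.Relation.Unary.Unique.Propositional using (Unique)
import Data.List.Relation.Unary.Unique.Propositional.Properties as UniqueP
open import Data.List.Relation.Unary.AllPairs using ([]; _∷_)
open import Data.Product using (Σ; ∃; _×_; _,_; proj₁; proj₂)
open import Data.Sum using (_⊎_; inj₁; inj₂)
open import Data.Unit using (⊤; tt)
open import Data.Empty using (⊥; ⊥-elim)
open import Relation.Nullary using (¬_; yes; no; Dec)
open import Relation.Nullary.Decidable using (_×-dec_; _→-dec_; map′; ¬?; toWitness)
open import Relation.Unary using (Decidable)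
open import Relation.Binary.Definitions using (tri<; tri≈; tri>)
open import Relation.Binary.PropositionalEquality
open import Function using (_∘_)
open import Function.Bundles using (_⇔_; mk⇔; Equivalence)

-- Permutations and insertion of the maximum

lookup-ext : ∀ {A : Set} {n} (u v : Vec A n) → (∀ i → lookup u i ≡ lookup v i) → u ≡ v
lookup-ext u v same =
  trans (sym (VP.tabulate∘lookup u)) (trans (VP.tabulate-cong same) (VP.tabulate∘lookup v))

perm-surjective : ∀ {n} (σ : Vec (Fin n) n) → IsPerm σ → ∀ v → ∃ λ i → lookup σ i ≡ v
perm-surjective {zero} σ σ-perm ()
perm-surjective {suc m} σ σ-perm v with FP.any? (λ i → lookup σ i FP.≟ v)
... | yes hit = hit
... | no miss = ⊥-elim (no-collision (FP.pigeonhole (ℕP.n<1+n m) squeeze))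
  where
  avoids-v : ∀ i → v ≢ lookup σ i
  avoids-v i eq = miss (i , sym eq)
  squeeze : Fin (suc m) → Fin m
  squeeze i = punchOut (avoids-v i)
  no-collision : (∃ λ i → ∃ λ j → i <ᶠ j × squeeze i ≡ squeeze j) → ⊥
  no-collision (i , j , i<j , eq)
    with σ-perm i j (FP.punchOut-injective (avoids-v i) (avoids-v j) eq)
  ... | refl = ℕP.<-irrefl refl i<j

insertMax : ∀ {n} → Fin (suc n) → Vec (Fin n) n → Vec (Fin (suc n)) (suc n)
insertMax {n} p σ = insertAt (V.map inject₁ σ) p (fromℕ n)

insertMax-at : ∀ {n} (p : Fin (suc n)) (σ : Vec (Fin n) n) → lookup (insertMax p σ) p ≡ fromℕ n
insertMax-at p σ = VP.insertAt-lookup _ p _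

insertMax-punchIn : ∀ {n} (p : Fin (suc n)) (σ : Vec (Fin n) n) i →
                    lookup (insertMax p σ) (punchIn p i) ≡ inject₁ (lookup σ i)
insertMax-punchIn p σ i = trans (VP.insertAt-punchIn _ p _ i) (VP.lookup-map i inject₁ σ)

position-split : ∀ {n} (p y : Fin (suc n)) → y ≡ p ⊎ ∃ λ i → y ≡ punchIn p i
position-split p y with p FP.≟ y
... | yes refl = inj₁ refl
... | no p≢y = inj₂ (punchOut p≢y , sym (FP.punchIn-punchOut p≢y))

insertMax-perm : ∀ {n} (p : Fin (suc n)) (σ : Vec (Fin n) n) → IsPerm σ → IsPerm (insertMax p σ)
insertMax-perm p σ σ-perm y z eq with position-split p y | position-split p z
... | inj₁ refl | inj₁ refl = refl
... | inj₁ refl | inj₂ (j , refl) = ⊥-elim (FP.fromℕ≢inject₁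
      (trans (sym (insertMax-at p σ)) (trans eq (insertMax-punchIn p σ j))))
... | inj₂ (i , refl) | inj₁ refl = ⊥-elim (FP.fromℕ≢inject₁
      (trans (sym (insertMax-at p σ)) (trans (sym eq) (insertMax-punchIn p σ i))))
... | inj₂ (i , refl) | inj₂ (j , refl) = cong (punchIn p) (σ-perm i j (FP.inject₁-injective
      (trans (sym (insertMax-punchIn p σ i)) (trans eq (insertMax-punchIn p σ j)))))

module RemoveMax {n} (σ' : Vec (Fin (suc n)) (suc n)) (σ'-perm : IsPerm σ') where
  position : Fin (suc n)
  position = proj₁ (perm-surjective σ' σ'-perm (fromℕ n))

  at-position : lookup σ' position ≡ fromℕ n
  at-position = proj₂ (perm-surjective σ' σ'-perm (fromℕ n))

  below-max : ∀ i → n ≢ toℕ (lookup σ' (punchIn position i))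
  below-max i eq = FP.punchInᵢ≢i position i (σ'-perm _ _
    (trans (FP.toℕ-injective (trans (sym eq) (sym (FP.toℕ-fromℕ n)))) (sym at-position)))

  rest : Vec (Fin n) n
  rest = tabulate (λ i → lower₁ (lookup σ' (punchIn position i)) (below-max i))

  rest-entry : ∀ i → inject₁ (lookup rest i) ≡ lookup σ' (punchIn position i)
  rest-entry i = trans (cong inject₁ (VP.lookup∘tabulate _ i)) (FP.inject₁-lower₁ _ (below-max i))

  reinsert : insertMax position rest ≡ σ'
  reinsert = lookup-ext _ _ entry
    where
    entry : ∀ y → lookup (insertMax position rest) y ≡ lookup σ' y
    entry y with position-split position y
    ... | inj₁ refl = trans (insertMax-at position rest) (sym at-position)
    ... | inj₂ (i , refl) = trans (insertMax-punchIn position rest i) (rest-entry i)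

  rest-perm : IsPerm rest
  rest-perm i j eq = FP.punchIn-injective position i j
    (σ'-perm _ _ (trans (sym (rest-entry i)) (trans (cong inject₁ eq) (rest-entry j))))

removeMax : ∀ {n} (σ' : Vec (Fin (suc n)) (suc n)) → IsPerm σ' →
            Σ (Fin (suc n)) λ p → Σ (Vec (Fin n) n) λ σ → IsPerm σ × insertMax p σ ≡ σ'
removeMax σ' σ'-perm = let open RemoveMax σ' σ'-perm in position , rest , rest-perm , reinsert

insertMax-injective : ∀ {n} (p q : Fin (suc n)) (σ τ : Vec (Fin n) n) →
                      insertMax p σ ≡ insertMax q τ → p ≡ q × σ ≡ τ
insertMax-injective p q σ τ eq with position-split q p
... | inj₂ (j , refl) = ⊥-elim (FP.fromℕ≢inject₁ (trans (sym (insertMax-at (punchIn q j) σ))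
      (trans (cong (λ v → lookup v (punchIn q j)) eq) (insertMax-punchIn q τ j))))
... | inj₁ refl = refl , lookup-ext σ τ (λ i → FP.inject₁-injective
      (trans (sym (insertMax-punchIn p σ i))
      (trans (cong (λ v → lookup v (punchIn p i)) eq) (insertMax-punchIn p τ i))))

inverse : ∀ {n} (σ : Vec (Fin n) n) → IsPerm σ → Vec (Fin n) n
inverse σ σ-perm = tabulate (λ v → proj₁ (perm-surjective σ σ-perm v))

-- σ ∘ σ⁻¹ = id, hence σ⁻¹ ∘ σ = id by injectivity.
inverse-right : ∀ {n} (σ : Vec (Fin n) n) (σ-perm : IsPerm σ) v →
                lookup σ (lookup (inverse σ σ-perm) v) ≡ v
inverse-right σ σ-perm v = trans (cong (lookup σ) (VP.lookup∘tabulate _ v))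
                                 (proj₂ (perm-surjective σ σ-perm v))

inverse-isInverse : ∀ {n} (σ : Vec (Fin n) n) (σ-perm : IsPerm σ) → IsInverse (inverse σ σ-perm) σ
inverse-isInverse σ σ-perm i = σ-perm _ _ (inverse-right σ σ-perm (lookup σ i))

inverse-unique : ∀ {n} (σ τ₁ τ₂ : Vec (Fin n) n) → IsPerm σ →
                 IsInverse τ₁ σ → IsInverse τ₂ σ → τ₁ ≡ τ₂
inverse-unique σ τ₁ τ₂ σ-perm inv₁ inv₂ = lookup-ext τ₁ τ₂ agree
  where
  agree : ∀ v → lookup τ₁ v ≡ lookup τ₂ v
  agree v with perm-surjective σ σ-perm v
  ... | i , refl = trans (inv₁ i) (sym (inv₂ i))

-- Patterns of length three

Pattern123 Pattern321 : ∀ {n} → Vec (Fin n) n → Set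
Pattern123 {n} σ = Σ (Fin n) λ i → Σ (Fin n) λ j → Σ (Fin n) λ k →
  i <ᶠ j × j <ᶠ k × lookup σ i <ᶠ lookup σ j × lookup σ j <ᶠ lookup σ k
Pattern321 {n} σ = Σ (Fin n) λ i → Σ (Fin n) λ j → Σ (Fin n) λ k →
  i <ᶠ j × j <ᶠ k × lookup σ k <ᶠ lookup σ j × lookup σ j <ᶠ lookup σ i

fin3-pairs : ∀ {P : Fin 3 → Fin 3 → Set} → P (# 0) (# 1) → P (# 0) (# 2) → P (# 1) (# 2) →
             ∀ x y → x <ᶠ y → P x y
fin3-pairs p01 p02 p12 fzero (fsuc fzero) _ = p01
fin3-pairs p01 p02 p12 fzero (fsuc (fsuc fzero)) _ = p02
fin3-pairs p01 p02 p12 (fsuc fzero) (fsuc (fsuc fzero)) _ = p12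
fin3-pairs p01 p02 p12 fzero fzero ()
fin3-pairs p01 p02 p12 (fsuc fzero) fzero ()
fin3-pairs p01 p02 p12 (fsuc fzero) (fsuc fzero) (s≤s ())
fin3-pairs p01 p02 p12 (fsuc (fsuc fzero)) y 2<y = ⊥-elim (ℕP.<⇒≱ (FP.toℕ<n y) 2<y)

Decreasing : ∀ {t m} → (Fin t → Fin m) → Set
Decreasing {t} f = ∀ (j k : Fin t) → j <ᶠ k → f k <ᶠ f j

increasing-reflects : ∀ {t m} (f : Fin t → Fin m) → StrictIncr f → ∀ x y → f x <ᶠ f y → x <ᶠ y
increasing-reflects f f-incr x y fx<fy with FP.<-cmp x y
... | tri< x<y _ _ = x<y
... | tri≈ _ refl _ = ⊥-elim (ℕP.<-irrefl refl fx<fy)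
... | tri> _ _ y<x = ⊥-elim (ℕP.<-asym fx<fy (f-incr y x y<x))

decreasing-reverses : ∀ {t m} (f : Fin t → Fin m) → Decreasing f → ∀ x y → f x <ᶠ f y → y <ᶠ x
decreasing-reverses f f-decr x y fx<fy with FP.<-cmp x y
... | tri< x<y _ _ = ⊥-elim (ℕP.<-asym fx<fy (f-decr x y x<y))
... | tri≈ _ refl _ = ⊥-elim (ℕP.<-irrefl refl fx<fy)
... | tri> _ _ y<x = y<x

triple : ∀ {n} → Fin n → Fin n → Fin n → Fin 3 → Fin n
triple i j k fzero = i
triple i j k (fsuc fzero) = j
triple i j k (fsuc (fsuc fzero)) = k

triple-chain : ∀ {n} (_≺_ : Fin n → Fin n → Set) → (∀ {x y z} → x ≺ y → y ≺ z → x ≺ z) →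
               ∀ {a b c} → a ≺ b → b ≺ c → ∀ x y → x <ᶠ y → triple a b c x ≺ triple a b c y
triple-chain _≺_ ≺-trans {a} {b} {c} a≺b b≺c =
  fin3-pairs {λ x y → triple a b c x ≺ triple a b c y} a≺b (≺-trans a≺b b≺c) b≺c

p123-increasing : StrictIncr (lookup p123)
p123-increasing = fin3-pairs (s≤s z≤n) (s≤s z≤n) (s≤s (s≤s z≤n))

p321-decreasing : Decreasing (lookup p321)
p321-decreasing = fin3-pairs (s≤s (s≤s z≤n)) (s≤s z≤n) (s≤s z≤n)

pattern123⇔ : ∀ {n} (σ : Vec (Fin n) n) → Contains σ p123 ⇔ Pattern123 σ
pattern123⇔ σ = mk⇔ extract embed
  where
  extract : Contains σ p123 → Pattern123 σ
  extract (idx , idx-incr , same-order) = idx (# 0) , idx (# 1) , idx (# 2) ,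
    idx-incr (# 0) (# 1) (s≤s z≤n) , idx-incr (# 1) (# 2) (s≤s (s≤s z≤n)) ,
    Equivalence.from (same-order (# 0) (# 1)) (p123-increasing (# 0) (# 1) (s≤s z≤n)) ,
    Equivalence.from (same-order (# 1) (# 2)) (p123-increasing (# 1) (# 2) (s≤s (s≤s z≤n)))
  embed : Pattern123 σ → Contains σ p123
  embed (i , j , k , i<j , j<k , σi<σj , σj<σk) = idx , idx-incr , same-order
    where
    idx = triple i j k
    idx-incr : StrictIncr idx
    idx-incr = triple-chain _<ᶠ_ ℕP.<-trans i<j j<k
    values-incr : StrictIncr (lookup σ ∘ idx)
    values-incr = triple-chain (λ x y → lookup σ x <ᶠ lookup σ y) ℕP.<-trans σi<σj σj<σk
    same-order : ∀ x y → (lookup σ (idx x) <ᶠ lookup σ (idx y)) ⇔ (lookup p123 x <ᶠ lookup p123 y)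
    same-order x y = mk⇔
      (λ lt → p123-increasing x y (increasing-reflects (lookup σ ∘ idx) values-incr x y lt))
      (λ lt → values-incr x y (increasing-reflects (lookup p123) p123-increasing x y lt))

pattern321⇔ : ∀ {n} (σ : Vec (Fin n) n) → Contains σ p321 ⇔ Pattern321 σ
pattern321⇔ σ = mk⇔ extract embed
  where
  extract : Contains σ p321 → Pattern321 σ
  extract (idx , idx-incr , same-order) = idx (# 0) , idx (# 1) , idx (# 2) ,
    idx-incr (# 0) (# 1) (s≤s z≤n) , idx-incr (# 1) (# 2) (s≤s (s≤s z≤n)) ,
    Equivalence.from (same-order (# 2) (# 1)) (p321-decreasing (# 1) (# 2) (s≤s (s≤s z≤n))) ,
    Equivalence.from (same-order (# 1) (# 0)) (p321-decreasing (# 0) (# 1) (s≤s z≤n))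
  embed : Pattern321 σ → Contains σ p321
  embed (i , j , k , i<j , j<k , σk<σj , σj<σi) = idx , idx-incr , same-order
    where
    idx = triple i j k
    idx-incr : StrictIncr idx
    idx-incr = triple-chain _<ᶠ_ ℕP.<-trans i<j j<k
    values-decr : Decreasing (lookup σ ∘ idx)
    values-decr = triple-chain (λ x y → lookup σ y <ᶠ lookup σ x) (λ y<x z<y → ℕP.<-trans z<y y<x)
                               σj<σi σk<σj
    same-order : ∀ x y → (lookup σ (idx x) <ᶠ lookup σ (idx y)) ⇔ (lookup p321 x <ᶠ lookup p321 y)
    same-order x y = mk⇔
      (λ lt → p321-decreasing y x (decreasing-reverses (lookup σ ∘ idx) values-decr x y lt))
      (λ lt → values-decr y x (decreasing-reverses (lookup p321) p321-decreasing x y lt))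

-- `punchIn` on naturals: make room for the value p by shifting everything at or above p up.
shift : ℕ → ℕ → ℕ
shift p x with x <? p
... | yes _ = x
... | no _ = suc x

shift-below : ∀ {p x} → x < p → shift p x ≡ x
shift-below {p} {x} x<p with x <? p
... | yes _ = refl
... | no x≮p = ⊥-elim (x≮p x<p)

shift-above : ∀ {p x} → p ≤ x → shift p x ≡ suc x
shift-above {p} {x} p≤x with x <? p
... | yes x<p = ⊥-elim (ℕP.<⇒≱ x<p p≤x)
... | no _ = refl

shift-mono : ∀ p {x y} → x < y → shift p x < shift p y
shift-mono p {x} {y} x<y with x <? p | y <? p
... | yes _ | yes _ = x<y
... | yes _ | no _ = ℕP.m<n⇒m<1+n x<y
... | no x≮p | yes y<p = ⊥-elim (x≮p (ℕP.<-trans x<y y<p))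
... | no _ | no _ = s≤s x<y

shift-cancel : ∀ p {x y} → shift p x < shift p y → x < y
shift-cancel p {x} {y} lt with ℕP.<-cmp x y
... | tri< x<y _ _ = x<y
... | tri≈ _ refl _ = ⊥-elim (ℕP.<-irrefl refl lt)
... | tri> _ _ y<x = ⊥-elim (ℕP.<-asym lt (shift-mono p y<x))

toℕ-punchIn : ∀ {n} (p : Fin (suc n)) (j : Fin n) → toℕ (punchIn p j) ≡ shift (toℕ p) (toℕ j)
toℕ-punchIn fzero j = sym (shift-above {0} {toℕ j} z≤n)
toℕ-punchIn (fsuc p) fzero = sym (shift-below {suc (toℕ p)} {0} (s≤s z≤n))
toℕ-punchIn (fsuc p) (fsuc j) = trans (cong suc (toℕ-punchIn p j)) (shift-suc (toℕ p) (toℕ j))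
  where
  shift-suc : ∀ a b → suc (shift a b) ≡ shift (suc a) (suc b)
  shift-suc a b with b <? a
  ... | yes b<a = sym (shift-below (s≤s b<a))
  ... | no b≮a = sym (shift-above (s≤s (ℕP.≮⇒≥ b≮a)))

punchIn-mono : ∀ {n} (p : Fin (suc n)) (i j : Fin n) → i <ᶠ j → punchIn p i <ᶠ punchIn p j
punchIn-mono p i j i<j =
  subst₂ _<_ (sym (toℕ-punchIn p i)) (sym (toℕ-punchIn p j)) (shift-mono (toℕ p) i<j)

punchIn-cancel : ∀ {n} (p : Fin (suc n)) (i j : Fin n) → punchIn p i <ᶠ punchIn p j → i <ᶠ j
punchIn-cancel p i j lt = shift-cancel (toℕ p) (subst₂ _<_ (toℕ-punchIn p i) (toℕ-punchIn p j) lt)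

value : ∀ {n} → Vec (Fin n) n → Fin n → ℕ
value σ i = toℕ (lookup σ i)

value-max : ∀ {n} (p : Fin (suc n)) (σ : Vec (Fin n) n) → value (insertMax p σ) p ≡ n
value-max {n} p σ = trans (cong toℕ (insertMax-at p σ)) (FP.toℕ-fromℕ n)

value-old : ∀ {n} (p : Fin (suc n)) (σ : Vec (Fin n) n) i →
            value (insertMax p σ) (punchIn p i) ≡ value σ i
value-old p σ i = trans (cong toℕ (insertMax-punchIn p σ i)) (FP.toℕ-inject₁ _)

value-bound : ∀ {n} (σ : Vec (Fin (suc n)) (suc n)) y → value σ y ≤ n
value-bound σ y = ℕP.<⇒≤pred (FP.toℕ<n (lookup σ y))

max-not-below : ∀ {n} (p : Fin (suc n)) (σ : Vec (Fin n) n) y →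
                ¬ (lookup (insertMax p σ) p <ᶠ lookup (insertMax p σ) y)
max-not-below p σ y lt = ℕP.<⇒≱ (subst (_< value (insertMax p σ) y) (value-max p σ) lt)
                                 (value-bound (insertMax p σ) y)

old-order : ∀ {n} (p : Fin (suc n)) (σ : Vec (Fin n) n) i j →
            lookup σ i <ᶠ lookup σ j ⇔
            lookup (insertMax p σ) (punchIn p i) <ᶠ lookup (insertMax p σ) (punchIn p j)
old-order p σ i j = mk⇔ (subst₂ _<_ (sym (value-old p σ i)) (sym (value-old p σ j)))
                        (subst₂ _<_ (value-old p σ i) (value-old p σ j))

pattern123-insert : ∀ {n} (p : Fin (suc n)) (σ : Vec (Fin n) n) →
                    Pattern123 σ → Pattern123 (insertMax p σ)
pattern123-insert p σ (i , j , k , i<j , j<k , σi<σj , σj<σk) =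
  punchIn p i , punchIn p j , punchIn p k , punchIn-mono p i j i<j , punchIn-mono p j k j<k ,
  Equivalence.to (old-order p σ i j) σi<σj , Equivalence.to (old-order p σ j k) σj<σk

pattern321-insert : ∀ {n} (p : Fin (suc n)) (σ : Vec (Fin n) n) →
                    Pattern321 σ → Pattern321 (insertMax p σ)
pattern321-insert p σ (i , j , k , i<j , j<k , σk<σj , σj<σi) =
  punchIn p i , punchIn p j , punchIn p k , punchIn-mono p i j i<j , punchIn-mono p j k j<k ,
  Equivalence.to (old-order p σ k j) σk<σj , Equivalence.to (old-order p σ j i) σj<σi

old-below-max : ∀ {n} (p : Fin (suc n)) (σ : Vec (Fin n) n) i →
                lookup (insertMax p σ) (punchIn p i) <ᶠ lookup (insertMax p σ) p
old-below-max p σ i = subst₂ _<_ (sym (value-old p σ i)) (sym (value-max p σ)) (FP.toℕ<n (lookup σ i))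

punchIn-left : ∀ {n} (p : Fin (suc n)) (i : Fin n) → toℕ i < toℕ p → toℕ (punchIn p i) ≡ toℕ i
punchIn-left p i i<p = trans (toℕ-punchIn p i) (shift-below i<p)

-- Part (i): DRS(321) consists of all 321-avoiding permutations

word : ∀ {n} → Vec (Fin n) n → List ℕ
word σ = map toℕ (toList σ)

-- `No21Below x l`: l has no subsequence z < y with y < x.
No21Below : ℕ → List ℕ → Set
No21Below x [] = ⊤
No21Below x (y ∷ ys) = (y < x → All (λ z → ¬ z < y) ys) × No21Below x ys

Free321 : List ℕ → Set
Free321 [] = ⊤
Free321 (x ∷ xs) = No21Below x xs × Free321 xs

-- A double descent is a (consecutive) 321 subsequence.
free321⇒noDoubleDescent : ∀ l → Free321 l → NoDoubleDescent l
free321⇒noDoubleDescent [] _ = tt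
free321⇒noDoubleDescent (a ∷ []) _ = tt
free321⇒noDoubleDescent (a ∷ b ∷ []) _ = tt
free321⇒noDoubleDescent (a ∷ b ∷ c ∷ r) ((b-ok , _) , rest-free) =
  (λ { (b<a , c<b) → All.head (b-ok b<a) c<b }) , free321⇒noDoubleDescent (b ∷ c ∷ r) rest-free

module _ {Q : ℕ → Set} (Q? : Decidable Q) where
  no21Below-filter : ∀ x l → No21Below x l → No21Below x (filter Q? l)
  no21Below-filter x [] _ = tt
  no21Below-filter x (y ∷ l) (y-ok , rest-ok) with Q? y
  ... | yes _ = (λ y<x → AllP.filter⁺ Q? (y-ok y<x)) , no21Below-filter x l rest-ok
  ... | no _ = no21Below-filter x l rest-ok

  free321-filter : ∀ l → Free321 l → Free321 (filter Q? l)
  free321-filter [] _ = tt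
  free321-filter (x ∷ l) (x-ok , rest-free) with Q? x
  ... | yes _ = no21Below-filter x l x-ok , free321-filter l rest-free
  ... | no _ = free321-filter l rest-free

module _ {n : ℕ} where
  private
    values : ∀ {m} → Vec (Fin n) m → List ℕ
    values w = map toℕ (toList w)

    all-values : ∀ {m} {Q : ℕ → Set} (w : Vec (Fin n) m) →
                 (∀ k → Q (toℕ (lookup w k))) → All Q (values w)
    all-values [] _ = []
    all-values (x ∷ w) h = h fzero ∷ all-values w (h ∘ fsuc)

    no21Below-values : ∀ {m} x (w : Vec (Fin n) m) →
      (∀ j k → j <ᶠ k → lookup w k <ᶠ lookup w j → toℕ (lookup w j) < x → ⊥) →
      No21Below x (values w)
    no21Below-values x [] _ = tt
    no21Below-values x (y ∷ w) no21 =
      (λ y<x → all-values w (λ k wk<y → no21 fzero (fsuc k) (s≤s z≤n) wk<y y<x)) ,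
      no21Below-values x w (λ j k j<k → no21 (fsuc j) (fsuc k) (s≤s j<k))

  free321-values : ∀ {m} (w : Vec (Fin n) m) →
    (∀ i j k → i <ᶠ j → j <ᶠ k → lookup w k <ᶠ lookup w j → lookup w j <ᶠ lookup w i → ⊥) →
    Free321 (values w)
  free321-values [] _ = tt
  free321-values (x ∷ w) no321 =
    no21Below-values (toℕ x) w (λ j k j<k → no321 fzero (fsuc j) (fsuc k) (s≤s z≤n) (s≤s j<k)) ,
    free321-values w (λ i j k i<j j<k → no321 (fsuc i) (fsuc j) (fsuc k) (s≤s i<j) (s≤s j<k))

avoid321⇒simsun : ∀ {n} (σ : Vec (Fin n) n) → ¬ Pattern321 σ → Simsun σ
avoid321⇒simsun σ no321 k = free321⇒noDoubleDescent _ (free321-filter (_<? k) (word σ)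
  (free321-values σ (λ i j k i<j j<k σk<σj σj<σi → no321 (i , j , k , i<j , j<k , σk<σj , σj<σi))))

-- A 321 in the inverse is a 321 in σ (read off at the values instead of the positions).
inverse-pattern321 : ∀ {n} (σ : Vec (Fin n) n) (σ-perm : IsPerm σ) →
                     Pattern321 (inverse σ σ-perm) → Pattern321 σ
inverse-pattern321 σ σ-perm (i , j , k , i<j , j<k , τk<τj , τj<τi) =
  τ k , τ j , τ i , τk<τj , τj<τi ,
  subst₂ _<ᶠ_ (sym (inverse-right σ σ-perm i)) (sym (inverse-right σ σ-perm j)) i<j ,
  subst₂ _<ᶠ_ (sym (inverse-right σ σ-perm j)) (sym (inverse-right σ σ-perm k)) j<k
  where τ = lookup (inverse σ σ-perm)

drs321⇒avoid : ∀ {n} (σ : Vec (Fin n) n) → DRS n p321 σ → IsPerm σ × ¬ Pattern321 σ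
drs321⇒avoid σ (σ-perm , avoids , _) = σ-perm , avoids ∘ Equivalence.from (pattern321⇔ σ)

avoid⇒drs321 : ∀ {n} (σ : Vec (Fin n) n) → IsPerm σ → ¬ Pattern321 σ → DRS n p321 σ
avoid⇒drs321 σ σ-perm no321 =
  σ-perm , no321 ∘ Equivalence.to (pattern321⇔ σ) , avoid321⇒simsun σ no321 ,
  inverse σ σ-perm , inverse-isInverse σ σ-perm ,
  avoid321⇒simsun (inverse σ σ-perm) (no321 ∘ inverse-pattern321 σ σ-perm)

-- Position i of σ is an inversion top if some later
-- entry is smaller; `TopsBefore σ m` says all inversion tops lie at positions < m.  Inserting
-- the maximum at p keeps σ 321-avoiding exactly when `TopsBefore σ p`.
TopsBefore : ∀ {n} → Vec (Fin n) n → ℕ → Set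
TopsBefore {n} σ m = ∀ (i j : Fin n) → i <ᶠ j → lookup σ j <ᶠ lookup σ i → toℕ i < m

module InsertIntoAvoider {n} (p : Fin (suc n)) (σ : Vec (Fin n) n) where
  private
    σ' = insertMax p σ

  -- An inversion top at or after p would form a 321 with the inserted maximum.
  avoiding⇒topsBefore : ¬ Pattern321 σ' → TopsBefore σ (toℕ p)
  avoiding⇒topsBefore no321 i j i<j σj<σi with toℕ i <? toℕ p
  ... | yes i<p = i<p
  ... | no i≮p = ⊥-elim (no321 (p , punchIn p i , punchIn p j ,
        subst (toℕ p <_) (sym (trans (toℕ-punchIn p i) (shift-above (ℕP.≮⇒≥ i≮p))))
              (s≤s (ℕP.≮⇒≥ i≮p)) ,
        punchIn-mono p i j i<j , Equivalence.to (old-order p σ j i) σj<σi , old-below-max p σ i))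

  -- Conversely, if all inversion tops precede p, a 321 of σ' never uses the maximum.
  topsBefore⇒pattern321 : TopsBefore σ (toℕ p) → Pattern321 σ' → Pattern321 σ
  topsBefore⇒pattern321 tops (i' , j' , k' , i'<j' , j'<k' , σk'<σj' , σj'<σi')
    with position-split p i' | position-split p j' | position-split p k'
  ... | _ | inj₁ refl | _ = ⊥-elim (max-not-below p σ i' σj'<σi')
  ... | _ | _ | inj₁ refl = ⊥-elim (max-not-below p σ j' σk'<σj')
  ... | inj₁ refl | inj₂ (j , refl) | inj₂ (k , refl) =
    ⊥-elim (ℕP.<-asym i'<j' (subst (_< toℕ p) (sym (punchIn-left p j j<p)) j<p))
    where
    j<p : toℕ j < toℕ p
    j<p = tops j k (punchIn-cancel p j k j'<k') (Equivalence.from (old-order p σ k j) σk'<σj')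
  ... | inj₂ (i , refl) | inj₂ (j , refl) | inj₂ (k , refl) =
    i , j , k , punchIn-cancel p i j i'<j' , punchIn-cancel p j k j'<k' ,
    Equivalence.from (old-order p σ k j) σk'<σj' , Equivalence.from (old-order p σ j i) σj'<σi'

  -- The inversion tops of σ' are those of σ that come before p, plus p itself;
  -- so when all tops of σ precede p < n, the tops of σ' are bounded by m exactly when p < m.
  topsBefore-inner : toℕ p < n → TopsBefore σ (toℕ p) → ∀ m → TopsBefore σ' m ⇔ toℕ p < m
  topsBefore-inner p<n tops m = mk⇔ p-is-top bounded
    where
    next : Fin n
    next = fromℕ< p<n
    p<next : toℕ p < toℕ (punchIn p next)
    p<next = subst (toℕ p <_) (sym (trans (toℕ-punchIn p next)
      (trans (cong (shift (toℕ p)) (FP.toℕ-fromℕ< p<n)) (shift-above ℕP.≤-refl)))) ℕP.≤-refl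
    p-is-top : TopsBefore σ' m → toℕ p < m
    p-is-top tops' = tops' p (punchIn p next) p<next (old-below-max p σ next)
    bounded : toℕ p < m → TopsBefore σ' m
    bounded p<m i' j' i'<j' σj'<σi' with position-split p i' | position-split p j'
    ... | inj₁ refl | _ = p<m
    ... | inj₂ (i , refl) | inj₁ refl = ⊥-elim (max-not-below p σ (punchIn p i) σj'<σi')
    ... | inj₂ (i , refl) | inj₂ (k , refl) =
      subst (_< m) (sym (punchIn-left p i i<p)) (ℕP.<-trans i<p p<m)
      where
      i<p : toℕ i < toℕ p
      i<p = tops i k (punchIn-cancel p i k i'<j') (Equivalence.from (old-order p σ k i) σj'<σi')

  topsBefore-last : toℕ p ≡ n → ∀ m → TopsBefore σ' m ⇔ TopsBefore σ m
  topsBefore-last p≡n m = mk⇔ restrict-tops extend-tops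
    where
    left-of-p : ∀ i → toℕ (punchIn p i) ≡ toℕ i
    left-of-p i = punchIn-left p i (subst (toℕ i <_) (sym p≡n) (FP.toℕ<n i))
    restrict-tops : TopsBefore σ' m → TopsBefore σ m
    restrict-tops tops' i k i<k σk<σi = subst (_< m) (left-of-p i)
      (tops' (punchIn p i) (punchIn p k) (punchIn-mono p i k i<k) (Equivalence.to (old-order p σ k i) σk<σi))
    extend-tops : TopsBefore σ m → TopsBefore σ' m
    extend-tops tops i' j' i'<j' σj'<σi' with position-split p i' | position-split p j'
    ... | inj₁ refl | _ = ⊥-elim (ℕP.<⇒≱ (subst (_< toℕ j') p≡n i'<j') (ℕP.<⇒≤pred (FP.toℕ<n j')))
    ... | inj₂ (i , refl) | inj₁ refl = ⊥-elim (max-not-below p σ (punchIn p i) σj'<σi')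
    ... | inj₂ (i , refl) | inj₂ (k , refl) = subst (_< m) (sym (left-of-p i))
      (tops i k (punchIn-cancel p i k i'<j') (Equivalence.from (old-order p σ k i) σj'<σi'))

-- A node is a permutation with a label k; the label is
-- correct when the positions m with `TopsBefore σ m` are exactly m ≥ n+1-k, i.e. σ has k
-- active sites n+1-k, …, n.
Label : ∀ {n} → Vec (Fin n) n → ℕ → Set
Label {n} σ k = ∀ m → TopsBefore σ m ⇔ suc n ≤ m + k

Node : ℕ → Set
Node n = Vec (Fin n) n × ℕ

WellLabelled : ∀ {n} → Node n → Set
WellLabelled {n} (σ , k) = IsPerm σ × ¬ Pattern321 σ × Label σ k × 1 ≤ k × k ≤ suc n

-- The active sites other than the last one: positions n-1, n-2, …, n-j of a node labelled j+1.
innerSites : (n j : ℕ) → List (Fin (suc n))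
innerSites n zero = []
innerSites zero (suc j) = []
innerSites (suc n) (suc j) = inject₁ (fromℕ n) ∷ map inject₁ (innerSites n j)

children : ∀ {n} → Node n → List (Node (suc n))
children (σ , zero) = []
children {n} (σ , suc j) =
  (insertMax (fromℕ n) σ , suc (suc j)) ∷ map (λ q → insertMax q σ , suc n ∸ toℕ q) (innerSites n j)

nextLevel : ∀ {n} → List (Node n) → List (Node (suc n))
nextLevel [] = []
nextLevel (x ∷ xs) = children x ++ nextLevel xs

level : (n : ℕ) → List (Node n)
level zero = ([] , 1) ∷ []
level (suc n) = nextLevel (level n)

toℕ-last-inner : ∀ n → toℕ (inject₁ (fromℕ n)) ≡ n
toℕ-last-inner n = trans (FP.toℕ-inject₁ (fromℕ n)) (FP.toℕ-fromℕ n)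

innerSite⇒bounds : ∀ n j q → q ∈ innerSites n j → toℕ q < n × n ≤ toℕ q + j
innerSite⇒bounds zero (suc j) q ()
innerSite⇒bounds (suc n) (suc j) q (here refl) =
  subst (_< suc n) (sym (toℕ-last-inner n)) ℕP.≤-refl ,
  subst (λ z → suc n ≤ z + suc j) (sym (toℕ-last-inner n))
        (subst (suc n ≤_) (sym (ℕP.+-suc n j)) (s≤s (ℕP.m≤m+n n j)))
innerSite⇒bounds (suc n) (suc j) q (there q∈) with ∈-map⁻ inject₁ q∈
... | q' , q'∈ , refl with innerSite⇒bounds n j q' q'∈
... | q'<n , n≤q'+j = subst (_< suc n) (sym (FP.toℕ-inject₁ q')) (ℕP.m<n⇒m<1+n q'<n) ,
  subst (λ z → suc n ≤ z + suc j) (sym (FP.toℕ-inject₁ q'))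
        (subst (suc n ≤_) (sym (ℕP.+-suc (toℕ q') j)) (s≤s n≤q'+j))

bounds⇒innerSite : ∀ n j (q : Fin (suc n)) → toℕ q < n → n ≤ toℕ q + j → q ∈ innerSites n j
bounds⇒innerSite n zero q q<n n≤q+0 =
  ⊥-elim (ℕP.<⇒≱ q<n (subst (n ≤_) (ℕP.+-identityʳ (toℕ q)) n≤q+0))
bounds⇒innerSite zero (suc j) q () _
bounds⇒innerSite (suc n) (suc j) q q<1+n n<q+1+j with toℕ q ℕP.≟ n
... | yes q≡n = here (FP.toℕ-injective (trans q≡n (sym (toℕ-last-inner n))))
... | no q≢n = subst (_∈ _) (FP.inject₁-lower₁ q 1+n≢q)
                     (there (∈-map⁺ inject₁ (bounds⇒innerSite n j q' q'<n n≤q'+j)))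
  where
  1+n≢q : suc n ≢ toℕ q
  1+n≢q eq = ℕP.<-irrefl (sym eq) q<1+n
  q' = lower₁ q 1+n≢q
  q'<n : toℕ q' < n
  q'<n = subst (_< n) (sym (FP.toℕ-lower₁ q 1+n≢q)) (ℕP.≤∧≢⇒< (ℕP.≤-pred q<1+n) q≢n)
  n≤q'+j : n ≤ toℕ q' + j
  n≤q'+j = subst (λ z → n ≤ z + j) (sym (FP.toℕ-lower₁ q 1+n≢q))
                 (ℕP.≤-pred (subst (suc n ≤_) (ℕP.+-suc (toℕ q) j) n<q+1+j))

innerSites-unique : ∀ n j → Unique (innerSites n j)
innerSites-unique n zero = []
innerSites-unique zero (suc j) = []
innerSites-unique (suc n) (suc j) =
  All.tabulate (λ q∈ eq → below-n q∈ (sym eq)) ∷ UniqueP.map⁺ FP.inject₁-injective (innerSites-unique n j)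
  where
  below-n : ∀ {q} → q ∈ map inject₁ (innerSites n j) → q ≢ inject₁ (fromℕ n)
  below-n q∈ eq with ∈-map⁻ inject₁ q∈
  ... | q' , q'∈ , refl = ℕP.<-irrefl (trans (cong toℕ (FP.inject₁-injective eq)) (FP.toℕ-fromℕ n))
                                      (proj₁ (innerSite⇒bounds n j q' q'∈))

threshold-shift : ∀ q s m → q < s → suc q ≤ m ⇔ suc s ≤ m + (s ∸ q)
threshold-shift q s m q<s = mk⇔
  (λ q<m → subst (_≤ m + (s ∸ q)) (cong suc q+d≡s) (ℕP.+-monoˡ-≤ (s ∸ q) q<m))
  (λ le → ℕP.+-cancelʳ-≤ (s ∸ q) (suc q) m (subst (_≤ m + (s ∸ q)) (cong suc (sym q+d≡s)) le))
  where
  q+d≡s : q + (s ∸ q) ≡ s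
  q+d≡s = ℕP.m+[n∸m]≡n (ℕP.<⇒≤ q<s)

root-wellLabelled : WellLabelled {0} ([] , 1)
root-wellLabelled =
  (λ ()) , (λ { (() , _) }) , (λ m → mk⇔ (λ _ → ℕP.m≤n+m 1 m) (λ _ ())) , s≤s z≤n , s≤s z≤n

last-child-wellLabelled : ∀ {n} (σ : Vec (Fin n) n) j → WellLabelled (σ , suc j) →
                          WellLabelled (insertMax (fromℕ n) σ , suc (suc j))
last-child-wellLabelled {n} σ j (σ-perm , no321 , label , _ , j≤n) =
  insertMax-perm p σ σ-perm , no321 ∘ topsBefore⇒pattern321 tops , label' , s≤s z≤n , s≤s j≤n
  where
  p = fromℕ n
  open InsertIntoAvoider p σ
  tops : TopsBefore σ (toℕ p)
  tops = Equivalence.from (label (toℕ p)) (subst (λ z → suc n ≤ z + suc j) (sym (FP.toℕ-fromℕ n))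
           (subst (suc n ≤_) (sym (ℕP.+-suc n j)) (s≤s (ℕP.m≤m+n n j))))
  label' : Label (insertMax p σ) (suc (suc j))
  label' m = mk⇔
    (λ tops' → subst (suc (suc n) ≤_) (sym (ℕP.+-suc m (suc j)))
      (s≤s (Equivalence.to (label m) (Equivalence.to (topsBefore-last (FP.toℕ-fromℕ n) m) tops'))))
    (λ le → Equivalence.from (topsBefore-last (FP.toℕ-fromℕ n) m) (Equivalence.from (label m)
      (ℕP.≤-pred (subst (suc (suc n) ≤_) (ℕP.+-suc m (suc j)) le))))

inner-child-wellLabelled : ∀ {n} (σ : Vec (Fin n) n) j q → q ∈ innerSites n j → WellLabelled (σ , suc j) →
                           WellLabelled (insertMax q σ , suc n ∸ toℕ q)
inner-child-wellLabelled {n} σ j q q∈ (σ-perm , no321 , label , _ , _) =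
  insertMax-perm q σ σ-perm , no321 ∘ topsBefore⇒pattern321 tops , label' ,
  ℕP.m<n⇒0<n∸m (ℕP.m<n⇒m<1+n q<n) , ℕP.≤-trans (ℕP.m∸n≤m (suc n) (toℕ q)) (ℕP.n≤1+n (suc n))
  where
  open InsertIntoAvoider q σ
  q<n = proj₁ (innerSite⇒bounds n j q q∈)
  tops : TopsBefore σ (toℕ q)
  tops = Equivalence.from (label (toℕ q))
    (subst (suc n ≤_) (sym (ℕP.+-suc (toℕ q) j)) (s≤s (proj₂ (innerSite⇒bounds n j q q∈))))
  label' : Label (insertMax q σ) (suc n ∸ toℕ q)
  label' m = mk⇔
    (Equivalence.to (threshold-shift (toℕ q) (suc n) m (ℕP.m<n⇒m<1+n q<n))
      ∘ Equivalence.to (topsBefore-inner q<n tops m))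
    (Equivalence.from (topsBefore-inner q<n tops m)
      ∘ Equivalence.from (threshold-shift (toℕ q) (suc n) m (ℕP.m<n⇒m<1+n q<n)))

children-wellLabelled : ∀ {n} (x : Node n) → WellLabelled x → ∀ y → y ∈ children x → WellLabelled y
children-wellLabelled (σ , zero) _ y ()
children-wellLabelled (σ , suc j) x-ok y (here refl) = last-child-wellLabelled σ j x-ok
children-wellLabelled {n} (σ , suc j) x-ok y (there y∈) with ∈-map⁻ (λ q → insertMax q σ , suc n ∸ toℕ q) y∈
... | q , q∈ , refl = inner-child-wellLabelled σ j q q∈ x-ok

level-wellLabelled : ∀ n → All WellLabelled (level n)
level-wellLabelled zero = root-wellLabelled ∷ []
level-wellLabelled (suc n) = nextLevel-wellLabelled (level n) (level-wellLabelled n)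
  where
  nextLevel-wellLabelled : ∀ {n} (xs : List (Node n)) → All WellLabelled xs → All WellLabelled (nextLevel xs)
  nextLevel-wellLabelled [] [] = []
  nextLevel-wellLabelled (x ∷ xs) (x-ok ∷ xs-ok) =
    AllP.++⁺ (All.tabulate (children-wellLabelled x x-ok _)) (nextLevel-wellLabelled xs xs-ok)

nextLevel⁺ : ∀ {n} {x : Node n} {y} (xs : List (Node n)) → x ∈ xs → y ∈ children x → y ∈ nextLevel xs
nextLevel⁺ (x ∷ xs) (here refl) y∈ = ∈-++⁺ˡ y∈
nextLevel⁺ (x' ∷ xs) (there x∈) y∈ = ∈-++⁺ʳ (children x') (nextLevel⁺ xs x∈ y∈)

nextLevel⁻ : ∀ {n} {y} (xs : List (Node n)) → y ∈ nextLevel xs → ∃ λ x → x ∈ xs × y ∈ children x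
nextLevel⁻ (x ∷ xs) y∈ with ∈-++⁻ (children x) y∈
... | inj₁ y∈children = x , here refl , y∈children
... | inj₂ y∈rest with nextLevel⁻ xs y∈rest
... | x' , x'∈ , y∈children = x' , there x'∈ , y∈children

-- A 321-avoiding insertion of the maximum into a well-labelled node is one of its children:
-- the insertion position is an active site.
avoiding-insertion-is-child : ∀ {n} (σ : Vec (Fin n) n) k p → WellLabelled (σ , k) →
                              ¬ Pattern321 (insertMax p σ) → ∃ λ k' → (insertMax p σ , k') ∈ children (σ , k)
avoiding-insertion-is-child σ zero p (_ , _ , _ , () , _) _
avoiding-insertion-is-child {n} σ (suc j) p (_ , _ , label , _ , _) no321 with toℕ p ℕP.≟ n
... | yes p≡n = suc (suc j) ,
  here (cong (λ r → insertMax r σ , suc (suc j)) (FP.toℕ-injective (trans p≡n (sym (FP.toℕ-fromℕ n)))))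
... | no p≢n = suc n ∸ toℕ p ,
  there (∈-map⁺ (λ q → insertMax q σ , suc n ∸ toℕ q) (bounds⇒innerSite n j p p<n n≤p+j))
  where
  p<n : toℕ p < n
  p<n = ℕP.≤∧≢⇒< (ℕP.≤-pred (FP.toℕ<n p)) p≢n
  n≤p+j : n ≤ toℕ p + j
  n≤p+j = ℕP.≤-pred (subst (suc n ≤_) (ℕP.+-suc (toℕ p) j)
            (Equivalence.to (label (toℕ p)) (InsertIntoAvoider.avoiding⇒topsBefore p σ no321)))

-- Every 321-avoider appears in its level: remove its maximum and find the parent by induction.
level-complete : ∀ n (σ : Vec (Fin n) n) → IsPerm σ → ¬ Pattern321 σ → ∃ λ k → (σ , k) ∈ level n
level-complete zero [] _ _ = 1 , here refl
level-complete (suc n) σ' σ'-perm no321' with removeMax σ' σ'-perm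
... | p , σ , σ-perm , refl with level-complete n σ σ-perm (no321' ∘ pattern321-insert p σ)
... | k , σ∈ with avoiding-insertion-is-child σ k p (All.lookup (level-wellLabelled n) σ∈) no321'
... | k' , child = k' , nextLevel⁺ (level n) σ∈ child

-- No permutation appears twice in a level: children of one node differ in the insertion
-- position, and children of different parents differ after removing the maximum.
child-shape : ∀ {n} (x : Node n) y → y ∈ children x → ∃ λ p → proj₁ y ≡ insertMax p (proj₁ x)
child-shape (σ , zero) y ()
child-shape {n} (σ , suc j) y (here refl) = fromℕ n , refl
child-shape {n} (σ , suc j) y (there y∈) with ∈-map⁻ (λ q → insertMax q σ , suc n ∸ toℕ q) y∈
... | q , _ , refl = q , refl

children-unique : ∀ {n} (x : Node n) → Unique (map proj₁ (children x))
children-unique (σ , zero) = []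
children-unique {n} (σ , suc j) = All.tabulate last-differs ∷ subst Unique (LP.map-∘ (innerSites n j))
  (UniqueP.map⁺ (λ eq → proj₁ (insertMax-injective _ _ σ σ eq)) (innerSites-unique n j))
  where
  last-differs : ∀ {τ} → τ ∈ map proj₁ (map (λ q → insertMax q σ , suc n ∸ toℕ q) (innerSites n j)) →
                 insertMax (fromℕ n) σ ≢ τ
  last-differs τ∈ eq with ∈-map⁻ proj₁ τ∈
  ... | y , y∈ , refl with ∈-map⁻ (λ q → insertMax q σ , suc n ∸ toℕ q) y∈
  ... | q , q∈ , refl = ℕP.<-irrefl (trans (sym (cong toℕ (proj₁ (insertMax-injective _ _ σ σ eq))))
                                           (FP.toℕ-fromℕ n))
                                    (proj₁ (innerSite⇒bounds n j q q∈))

nextLevel-unique : ∀ {n} (xs : List (Node n)) → Unique (map proj₁ xs) → Unique (map proj₁ (nextLevel xs))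
nextLevel-unique [] _ = []
nextLevel-unique (x ∷ xs) (x-new ∷ xs-unique) = subst Unique (sym (LP.map-++ proj₁ (children x) (nextLevel xs)))
  (UniqueP.++⁺ (children-unique x) (nextLevel-unique xs xs-unique) disjoint)
  where
  disjoint : ∀ {τ} → ¬ (τ ∈ map proj₁ (children x) × τ ∈ map proj₁ (nextLevel xs))
  disjoint (τ∈ , τ∈′) with ∈-map⁻ proj₁ τ∈ | ∈-map⁻ proj₁ τ∈′
  ... | y , y∈ , refl | y′ , y′∈ , eq with child-shape x y y∈ | nextLevel⁻ xs y′∈
  ... | p , y≡ | x′ , x′∈ , y′∈children with child-shape x′ y′ y′∈children
  ... | p′ , y′≡ = All.lookup x-new (∈-map⁺ proj₁ x′∈)
                     (proj₂ (insertMax-injective _ _ _ _ (trans (sym y≡) (trans eq y′≡))))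

level-unique : ∀ n → Unique (map proj₁ (level n))
level-unique zero = [] ∷ []
level-unique (suc n) = nextLevel-unique (level n) (level-unique n)

level-members : ∀ n (σ : Vec (Fin n) n) → (σ ∈ map proj₁ (level n)) ⇔ DRS n p321 σ
level-members n σ = mk⇔ member⇒drs drs⇒member
  where
  member⇒drs : σ ∈ map proj₁ (level n) → DRS n p321 σ
  member⇒drs σ∈ with ∈-map⁻ proj₁ σ∈
  ... | y , y∈ , refl with All.lookup (level-wellLabelled n) y∈
  ... | σ-perm , no321 , _ = avoid⇒drs321 (proj₁ y) σ-perm no321
  drs⇒member : DRS n p321 σ → σ ∈ map proj₁ (level n)
  drs⇒member drs with drs321⇒avoid σ drs
  ... | σ-perm , no321 = ∈-map⁺ proj₁ (proj₂ (level-complete n σ σ-perm no321))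

-- Counting the levels.  Summing a function h of the labels over the children of a node
-- labelled k gives h(k+1) + h(2) + … + h(k); iterating, level n has `descendants n 1` nodes.

sumFrom2 : (ℕ → ℕ) → ℕ → ℕ
sumFrom2 h zero = 0
sumFrom2 h (suc zero) = 0
sumFrom2 h (suc (suc m)) = sumFrom2 h (suc m) + h (suc (suc m))

childTotal : (ℕ → ℕ) → ℕ → ℕ
childTotal h k = h (suc k) + sumFrom2 h k

descendants : ℕ → ℕ → ℕ
descendants zero k = 1
descendants (suc r) k = childTotal (descendants r) k

sumFrom2-shift : ∀ h m → sumFrom2 h (suc (suc m)) ≡ h 2 + sumFrom2 (h ∘ suc) (suc m)
sumFrom2-shift h zero = ℕP.+-comm 0 (h 2)
sumFrom2-shift h (suc m) =
  trans (cong (_+ h (suc (suc (suc m)))) (sumFrom2-shift h m)) (ℕP.+-assoc (h 2) _ _)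

-- The inner sites n-1, …, n-j receive the labels 2, …, j+1.
innerSites-sum : ∀ n j → j ≤ n → ∀ h →
                 sum (map (λ q → h (suc n ∸ toℕ q)) (innerSites n j)) ≡ sumFrom2 h (suc j)
innerSites-sum n zero _ h = refl
innerSites-sum zero (suc j) () h
innerSites-sum (suc n) (suc j) (s≤s j≤n) h = trans (cong₂ _+_ first-label rest-labels) (sym (sumFrom2-shift h j))
  where
  first-label : h (suc (suc n) ∸ toℕ (inject₁ (fromℕ n))) ≡ h 2
  first-label = cong h (trans (cong (suc (suc n) ∸_) (toℕ-last-inner n)) (ℕP.m+n∸n≡m 2 n))
  shifted-label : ∀ q → q ∈ innerSites n j →
                  h (suc (suc n) ∸ toℕ (inject₁ q)) ≡ (h ∘ suc) (suc n ∸ toℕ q)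
  shifted-label q q∈ = cong h (trans (cong (suc (suc n) ∸_) (FP.toℕ-inject₁ q))
    (ℕP.+-∸-assoc 1 (ℕP.<⇒≤ (ℕP.m<n⇒m<1+n (proj₁ (innerSite⇒bounds n j q q∈))))))
  rest-labels : sum (map (λ q → h (suc (suc n) ∸ toℕ q)) (map inject₁ (innerSites n j))) ≡
                sumFrom2 (h ∘ suc) (suc j)
  rest-labels = trans (cong sum (sym (LP.map-∘ (innerSites n j))))
    (trans (cong sum (LP.map-cong-local (All.tabulate (λ {q} → shifted-label q))))
           (innerSites-sum n j j≤n (h ∘ suc)))

children-sum : ∀ {n} (x : Node n) → 1 ≤ proj₂ x → proj₂ x ≤ suc n → ∀ h →
               sum (map (h ∘ proj₂) (children x)) ≡ childTotal h (proj₂ x)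
children-sum (σ , zero) () _ h
children-sum {n} (σ , suc j) _ (s≤s j≤n) h =
  cong (h (suc (suc j)) +_) (trans (cong sum (sym (LP.map-∘ (innerSites n j)))) (innerSites-sum n j j≤n h))

nextLevel-sum : ∀ {n} (xs : List (Node n)) → All WellLabelled xs → ∀ h →
                sum (map (h ∘ proj₂) (nextLevel xs)) ≡ sum (map (childTotal h ∘ proj₂) xs)
nextLevel-sum [] [] h = refl
nextLevel-sum (x ∷ xs) ((_ , _ , _ , 1≤k , k≤1+n) ∷ xs-ok) h =
  trans (cong sum (LP.map-++ (h ∘ proj₂) (children x) (nextLevel xs)))
  (trans (sum-++ (map (h ∘ proj₂) (children x)) _)
  (cong₂ _+_ (children-sum x 1≤k k≤1+n h) (nextLevel-sum xs xs-ok h)))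

level-sum : ∀ n r → sum (map (descendants r ∘ proj₂) (level n)) ≡ descendants (n + r) 1
level-sum zero r = ℕP.+-identityʳ (descendants r 1)
level-sum (suc n) r = begin
  sum (map (descendants r ∘ proj₂) (nextLevel (level n)))
    ≡⟨ nextLevel-sum (level n) (level-wellLabelled n) (descendants r) ⟩
  sum (map (descendants (suc r) ∘ proj₂) (level n))  ≡⟨ level-sum n (suc r) ⟩
  descendants (n + suc r) 1                          ≡⟨ cong (λ m → descendants m 1) (ℕP.+-suc n r) ⟩
  descendants (suc n + r) 1                          ∎
  where open ≡-Reasoning

level-length : ∀ n → length (map proj₁ (level n)) ≡ descendants n 1
level-length n = begin
  length (map proj₁ (level n))               ≡⟨ LP.length-map proj₁ (level n) ⟩
  length (level n)                           ≡⟨ sum-ones (level n) ⟨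
  sum (map (descendants 0 ∘ proj₂) (level n)) ≡⟨ level-sum n 0 ⟩
  descendants (n + 0) 1                      ≡⟨ cong (λ m → descendants m 1) (ℕP.+-identityʳ n) ⟩
  descendants n 1                            ∎
  where
  open ≡-Reasoning
  sum-ones : ∀ {A : Set} (l : List A) → sum (map (λ _ → 1) l) ≡ length l
  sum-ones [] = refl
  sum-ones (x ∷ l) = cong suc (sum-ones l)

-- Closed form.  With N = 2r+k+2, a node labelled k+1 has C(N, r+1) − C(N, r) descendants
-- r+1 levels down (a ballot number); for k = 0 this is the Catalan number C_{r+1}.

absorption : ∀ N k → suc k * (suc N C suc k) ≡ suc N * (N C k)
absorption zero zero = refl
absorption zero (suc k) = begin
  suc (suc k) * (1 C suc (suc k)) ≡⟨ cong (suc (suc k) *_) (k>n⇒nCk≡0 {1} {suc (suc k)} (s≤s (s≤s z≤n))) ⟩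
  suc (suc k) * 0                 ≡⟨ ℕP.*-zeroʳ (suc (suc k)) ⟩
  0                               ≡⟨ cong (1 *_) (k>n⇒nCk≡0 {0} {suc k} (s≤s z≤n)) ⟨
  1 * (0 C suc k)                 ∎
  where open ≡-Reasoning
absorption (suc N) zero =
  trans (ℕP.+-identityʳ _) (trans (nC1≡n (suc (suc N))) (sym (ℕP.*-identityʳ (suc (suc N)))))
absorption (suc N) (suc k) = begin
  suc (suc k) * (suc (suc N) C suc (suc k))          ≡⟨ cong (suc (suc k) *_) (pascal (suc N) (suc k)) ⟨
  suc (suc k) * (P + Q)                              ≡⟨ expand k P Q ⟩
  suc k * P + P + suc (suc k) * Q
    ≡⟨ cong₂ (λ a b → a + P + b) (absorption N k) (absorption N (suc k)) ⟩
  suc N * (N C k) + P + suc N * (N C suc k)          ≡⟨ collect (suc N) (N C k) P (N C suc k) ⟩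
  suc N * (N C k + N C suc k) + P                    ≡⟨ cong (λ z → suc N * z + P) (pascal N k) ⟩
  suc N * P + P                                      ≡⟨ ℕP.+-comm (suc N * P) P ⟩
  suc (suc N) * P                                    ∎
  where
  open ≡-Reasoning
  pascal = nCk+nC[k+1]≡[n+1]C[k+1]
  P = suc N C suc k
  Q = suc N C suc (suc k)
  expand : ∀ k P Q → suc (suc k) * (P + Q) ≡ suc k * P + P + suc (suc k) * Q
  expand = solve-∀
  collect : ∀ a x P y → a * x + P + a * y ≡ a * (x + y) + P
  collect = solve-∀

-- Recurrences for `descendants` read off from the rule (k) ↦ (k+1)(2)…(k).
descendants-1 : ∀ r → descendants (suc r) 1 ≡ descendants r 2
descendants-1 r = ℕP.+-identityʳ _

descendants-step : ∀ r k → descendants (suc r) (suc (suc k)) ≡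
                           descendants (suc r) (suc k) + descendants r (suc (suc (suc k)))
descendants-step r k = regroup (descendants r (3 + k)) (sumFrom2 (descendants r) (suc k)) (descendants r (2 + k))
  where
  regroup : ∀ a b c → a + (b + c) ≡ (c + b) + a
  regroup = solve-∀

descendants-one-level : ∀ k → descendants 1 (suc k) ≡ suc k
descendants-one-level k = cong suc (count-ones k)
  where
  count-ones : ∀ k → sumFrom2 (descendants 0) (suc k) ≡ k
  count-ones zero = refl
  count-ones (suc k) = trans (cong (_+ 1) (count-ones k)) (ℕP.+-comm k 1)

ballot : ∀ r k N → N ≡ 2 + (r + r + k) → descendants (suc r) (suc k) + N C r ≡ N C suc r
ballot zero k N refl =
  trans (cong (_+ 1) (descendants-one-level k)) (trans (ℕP.+-comm (suc k) 1) (sym (nC1≡n (2 + k))))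
ballot (suc r) zero N N≡ = begin
  descendants (2 + r) 1 + N C suc r
    ≡⟨ cong₂ _+_ (descendants-1 (suc r)) (trans (cong (_C suc r) N≡1+M) (sym (pascal M r))) ⟩
  descendants (suc r) 2 + (M C r + M C suc r) ≡⟨ ℕP.+-assoc (descendants (suc r) 2) _ _ ⟨
  (descendants (suc r) 2 + M C r) + M C suc r ≡⟨ cong (_+ M C suc r) (ballot r 1 M M≡) ⟩
  M C suc r + M C suc r                  ≡⟨ cong (M C suc r +_) middle-symmetry ⟩
  M C suc r + M C suc (suc r)            ≡⟨ pascal M (suc r) ⟩
  suc M C suc (suc r)                    ≡⟨ cong (_C suc (suc r)) N≡1+M ⟨
  N C suc (suc r)                        ∎
  where
  open ≡-Reasoning
  pascal = nCk+nC[k+1]≡[n+1]C[k+1]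
  M = 3 + (r + r)
  M≡ : M ≡ 2 + (r + r + 1)
  M≡ = cong (2 +_) (ℕP.+-comm 1 (r + r))
  N≡1+M : N ≡ suc M
  N≡1+M = trans N≡ (cong (2 +_) (rearrange r))
    where
    rearrange : ∀ r → suc r + suc r + 0 ≡ 2 + (r + r)
    rearrange = solve-∀
  middle-symmetry : M C suc r ≡ M C suc (suc r)
  middle-symmetry =
    trans (nCk≡nC[n∸k] (s≤s (ℕP.≤-trans (ℕP.m≤m+n r r) (ℕP.≤-trans (ℕP.n≤1+n _) (ℕP.n≤1+n _)))))
    (cong (M C_) (trans (ℕP.+-∸-assoc 2 {r + r} {r} (ℕP.m≤m+n r r)) (cong (2 +_) (ℕP.m+n∸m≡n r r))))
ballot (suc r) (suc k) N N≡ = begin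
  descendants (2 + r) (2 + k) + N C suc r
    ≡⟨ cong₂ _+_ (descendants-step (suc r) k) (trans (cong (_C suc r) N≡1+M) (sym (pascal M r))) ⟩
  (descendants (2 + r) (suc k) + descendants (suc r) (3 + k)) + (M C r + M C suc r)
                                            ≡⟨ recombine (ballot (suc r) k M refl) (ballot r (2 + k) M M≡) ⟩
  M C suc r + M C suc (suc r)               ≡⟨ pascal M (suc r) ⟩
  suc M C suc (suc r)                       ≡⟨ cong (_C suc (suc r)) N≡1+M ⟨
  N C suc (suc r)                           ∎
  where
  open ≡-Reasoning
  pascal = nCk+nC[k+1]≡[n+1]C[k+1]
  M = 2 + (suc r + suc r + k)
  M≡ : M ≡ 2 + (r + r + (2 + k))
  M≡ = cong (2 +_) (rearrange r k)
    where
    rearrange : ∀ r k → suc r + suc r + k ≡ r + r + (2 + k)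
    rearrange = solve-∀
  N≡1+M : N ≡ suc M
  N≡1+M = trans N≡ (cong (2 +_) (rearrange r k))
    where
    rearrange : ∀ r k → suc r + suc r + suc k ≡ suc (suc r + suc r + k)
    rearrange = solve-∀
  recombine : ∀ {a b x y z} → a + y ≡ z → b + x ≡ y → (a + b) + (x + y) ≡ y + z
  recombine {a} {b} {x} {y} {z} a+y≡z b+x≡y =
    trans (shuffle a b x y) (trans (cong₂ _+_ a+y≡z b+x≡y) (ℕP.+-comm z y))
    where
    shuffle : ∀ a b x y → (a + b) + (x + y) ≡ (a + y) + (b + x)
    shuffle = solve-∀

-- C_{r+1} = C(2r+2, r+1) / (r+2) = C(2r+2, r+1) − C(2r+2, r).
descendants-catalan : ∀ r → descendants (suc r) 1 ≡ catalan (suc r)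
descendants-catalan r = sym (begin
  catalan (suc r)           ≡⟨ cong (_/ suc (suc r)) (trans (cong (_C suc r) (two-r r)) (sym u*[r+2]≡X)) ⟩
  u * suc (suc r) / suc (suc r) ≡⟨ m*n/n≡m u (suc (suc r)) ⟩
  u                         ∎)
  where
  open ≡-Reasoning
  N = 2 + (r + r)
  X = N C suc r
  Y = N C r
  u = descendants (suc r) 1
  two-r : ∀ r → 2 * suc r ≡ 2 + (r + r)
  two-r = solve-∀
  u+Y≡X : u + Y ≡ X
  u+Y≡X = ballot r 0 N (cong (2 +_) (sym (ℕP.+-identityʳ (r + r))))
  -- (r+1)·X = (r+2)·Y, both being (2r+2)·C(2r+1, r) by absorption and symmetry
  Y≡ : Y ≡ N C suc (suc r)
  Y≡ = trans (nCk≡nC[n∸k] (ℕP.≤-trans (ℕP.m≤m+n r r) (ℕP.≤-trans (ℕP.n≤1+n _) (ℕP.n≤1+n _))))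
             (cong (N C_) (trans (ℕP.+-∸-assoc 2 {r + r} {r} (ℕP.m≤m+n r r)) (cong (2 +_) (ℕP.m+n∸m≡n r r))))
  odd-symmetry : suc (r + r) C suc r ≡ suc (r + r) C r
  odd-symmetry = trans (nCk≡nC[n∸k] (s≤s (ℕP.m≤m+n r r))) (cong (suc (r + r) C_) (ℕP.m+n∸m≡n r r))
  balance : suc r * X ≡ suc (suc r) * Y
  balance = begin
    suc r * X                              ≡⟨ absorption (suc (r + r)) r ⟩
    N * (suc (r + r) C r)                  ≡⟨ cong (N *_) odd-symmetry ⟨
    N * (suc (r + r) C suc r)              ≡⟨ absorption (suc (r + r)) (suc r) ⟨
    suc (suc r) * (N C suc (suc r))        ≡⟨ cong (suc (suc r) *_) Y≡ ⟨
    suc (suc r) * Y                        ∎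
  u*[r+2]≡X : u * suc (suc r) ≡ X
  u*[r+2]≡X = ℕP.+-cancelˡ-≡ (suc r * X) _ _ (begin
    suc r * X + u * suc (suc r)            ≡⟨ cong (_+ u * suc (suc r)) balance ⟩
    suc (suc r) * Y + u * suc (suc r)      ≡⟨ factor (suc r) Y u ⟩
    suc (suc r) * (u + Y)                  ≡⟨ cong (suc (suc r) *_) u+Y≡X ⟩
    suc (suc r) * X                        ≡⟨ split-off r X ⟩
    suc r * X + X                          ∎)
    where
    factor : ∀ s Y u → suc s * Y + u * suc s ≡ suc s * (u + Y)
    factor = solve-∀
    split-off : ∀ r X → suc (suc r) * X ≡ suc r * X + X
    split-off = solve-∀

-- Part (ii): DRS(123)

filter-insertAt : ∀ {Q : ℕ → Set} (Q? : Decidable Q) {B : Set} {m} (f : B → ℕ) (xs : Vec B m) p v →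
                  ¬ Q (f v) → filter Q? (map f (toList (insertAt xs p v))) ≡ filter Q? (map f (toList xs))
filter-insertAt Q? f xs fzero v ¬Qv = LP.filter-reject Q? ¬Qv
filter-insertAt Q? f (x ∷ xs) (fsuc p) v ¬Qv with Q? (f x)
... | yes _ = cong (f x ∷_) (filter-insertAt Q? f xs p v ¬Qv)
... | no _ = filter-insertAt Q? f xs p v ¬Qv

filter-map : ∀ {Q R : ℕ → Set} (Q? : Decidable Q) (R? : Decidable R) (f : ℕ → ℕ) →
             (∀ x → Q (f x) ⇔ R x) → ∀ l → filter Q? (map f l) ≡ map f (filter R? l)
filter-map Q? R? f translate [] = refl
filter-map Q? R? f translate (x ∷ l) with R? x
... | yes Rx = trans (LP.filter-accept Q? (Equivalence.from (translate x) Rx))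
                     (cong (f x ∷_) (filter-map Q? R? f translate l))
... | no ¬Rx = trans (LP.filter-reject Q? (¬Rx ∘ Equivalence.to (translate x)))
                     (filter-map Q? R? f translate l)

-- Double descents only depend on the relative order of the letters.
noDoubleDescent-shift : ∀ p l → NoDoubleDescent (map (shift p) l) ⇔ NoDoubleDescent l
noDoubleDescent-shift p l = mk⇔ (reflect l) (preserve l)
  where
  reflect : ∀ l → NoDoubleDescent (map (shift p) l) → NoDoubleDescent l
  reflect [] _ = tt
  reflect (a ∷ []) _ = tt
  reflect (a ∷ b ∷ []) _ = tt
  reflect (a ∷ b ∷ c ∷ r) (ok , rest) =
    (λ { (b<a , c<b) → ok (shift-mono p b<a , shift-mono p c<b) }) , reflect (b ∷ c ∷ r) rest
  preserve : ∀ l → NoDoubleDescent l → NoDoubleDescent (map (shift p) l)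
  preserve [] _ = tt
  preserve (a ∷ []) _ = tt
  preserve (a ∷ b ∷ []) _ = tt
  preserve (a ∷ b ∷ c ∷ r) (ok , rest) =
    (λ { (b<a , c<b) → ok (shift-cancel p b<a , shift-cancel p c<b) }) , preserve (b ∷ c ∷ r) rest

noDoubleDescent-prefix : ∀ X Y → NoDoubleDescent (X ++ Y) → NoDoubleDescent X
noDoubleDescent-prefix [] Y _ = tt
noDoubleDescent-prefix (a ∷ []) Y _ = tt
noDoubleDescent-prefix (a ∷ b ∷ []) Y _ = tt
noDoubleDescent-prefix (a ∷ b ∷ c ∷ r) Y (ok , rest) = ok , noDoubleDescent-prefix (b ∷ c ∷ r) Y rest

word-bound : ∀ {n} (σ : Vec (Fin n) n) → All (_< n) (word σ)
word-bound {n} σ = entries σ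
  where
  entries : ∀ {m} (w : Vec (Fin n) m) → All (_< n) (map toℕ (toList w))
  entries [] = []
  entries (x ∷ w) = FP.toℕ<n x ∷ entries w

restrict-whole : ∀ {n} (σ : Vec (Fin n) n) k → n ≤ k → restrict k (word σ) ≡ word σ
restrict-whole σ k n≤k = LP.filter-all (_<? k) (All.map (λ x<n → ℕP.<-≤-trans x<n n≤k) (word-bound σ))

simsun-upTo : ∀ {n} (σ : Vec (Fin n) n) → (∀ k → k ≤ n → NoDoubleDescent (restrict k (word σ))) → Simsun σ
simsun-upTo {n} σ small k with k ≤? n
... | yes k≤n = small k k≤n
... | no k≰n = subst NoDoubleDescent (trans (restrict-whole σ n ℕP.≤-refl)
                 (sym (restrict-whole σ k (ℕP.<⇒≤ (ℕP.≰⇒> k≰n))))) (small n ℕP.≤-refl)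

word-inject₁ : ∀ {n m} (w : Vec (Fin n) m) → map toℕ (toList (V.map inject₁ w)) ≡ map toℕ (toList w)
word-inject₁ [] = refl
word-inject₁ (x ∷ w) = cong₂ _∷_ (FP.toℕ-inject₁ x) (word-inject₁ w)

restrict-insertMax : ∀ {n} (p : Fin (suc n)) (σ : Vec (Fin n) n) k → k ≤ n →
                     restrict k (word (insertMax p σ)) ≡ restrict k (word σ)
restrict-insertMax {n} p σ k k≤n =
  trans (filter-insertAt (_<? k) toℕ (V.map inject₁ σ) p (fromℕ n)
          (λ n<k → ℕP.<⇒≱ n<k (subst (k ≤_) (sym (FP.toℕ-fromℕ n)) k≤n)))
        (cong (restrict k) (word-inject₁ σ))

simsun-removeMax : ∀ {n} (p : Fin (suc n)) (σ : Vec (Fin n) n) → Simsun (insertMax p σ) → Simsun σ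
simsun-removeMax p σ simsun' =
  simsun-upTo σ (λ k k≤n → subst NoDoubleDescent (restrict-insertMax p σ k k≤n) (simsun' k))

simsun-insertMax : ∀ {n} (p : Fin (suc n)) (σ : Vec (Fin n) n) → Simsun σ →
                   NoDoubleDescent (word (insertMax p σ)) → Simsun (insertMax p σ)
simsun-insertMax {n} p σ simsun no-dd = simsun-upTo (insertMax p σ) small
  where
  small : ∀ k → k ≤ suc n → NoDoubleDescent (restrict k (word (insertMax p σ)))
  small k _ with k ≤? n
  ... | yes k≤n = subst NoDoubleDescent (sym (restrict-insertMax p σ k k≤n)) (simsun k)
  ... | no k≰n = subst NoDoubleDescent (sym (restrict-whole (insertMax p σ) k (ℕP.≰⇒> k≰n))) no-dd

insertMaxInverse : ∀ {n} → Fin (suc n) → Vec (Fin n) n → Vec (Fin (suc n)) (suc n)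
insertMaxInverse p τ = V.map (punchIn p) τ ∷ʳ p

lookup-∷ʳ-last : ∀ {A : Set} {m} (xs : Vec A m) a → lookup (xs ∷ʳ a) (fromℕ m) ≡ a
lookup-∷ʳ-last [] a = refl
lookup-∷ʳ-last (x ∷ xs) a = lookup-∷ʳ-last xs a

lookup-∷ʳ-inject₁ : ∀ {A : Set} {m} (xs : Vec A m) a i → lookup (xs ∷ʳ a) (inject₁ i) ≡ lookup xs i
lookup-∷ʳ-inject₁ (x ∷ xs) a fzero = refl
lookup-∷ʳ-inject₁ (x ∷ xs) a (fsuc i) = lookup-∷ʳ-inject₁ xs a i

insertMaxInverse-isInverse : ∀ {n} (p : Fin (suc n)) (σ τ : Vec (Fin n) n) → IsInverse τ σ →
                             IsInverse (insertMaxInverse p τ) (insertMax p σ)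
insertMaxInverse-isInverse p σ τ τσ≡id y with position-split p y
... | inj₁ refl = trans (cong (lookup (insertMaxInverse p τ)) (insertMax-at p σ))
                        (lookup-∷ʳ-last (V.map (punchIn p) τ) p)
... | inj₂ (i , refl) = begin
  lookup (insertMaxInverse p τ) (lookup (insertMax p σ) (punchIn p i))
    ≡⟨ cong (lookup (insertMaxInverse p τ)) (insertMax-punchIn p σ i) ⟩
  lookup (insertMaxInverse p τ) (inject₁ (lookup σ i))
    ≡⟨ lookup-∷ʳ-inject₁ (V.map (punchIn p) τ) p (lookup σ i) ⟩
  lookup (V.map (punchIn p) τ) (lookup σ i) ≡⟨ VP.lookup-map (lookup σ i) (punchIn p) τ ⟩
  punchIn p (lookup τ (lookup σ i))         ≡⟨ cong (punchIn p) (τσ≡id i) ⟩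
  punchIn p i                               ∎
  where open ≡-Reasoning

word-insertMaxInverse : ∀ {n} (p : Fin (suc n)) (τ : Vec (Fin n) n) →
                        word (insertMaxInverse p τ) ≡ map (shift (toℕ p)) (word τ) ++ toℕ p ∷ []
word-insertMaxInverse p τ = trans (cong (map toℕ) (VP.toList-∷ʳ p (V.map (punchIn p) τ)))
  (trans (LP.map-++ toℕ (toList (V.map (punchIn p) τ)) (p ∷ [])) (cong (_++ toℕ p ∷ []) (shifted τ)))
  where
  shifted : ∀ {m} (w : Vec (Fin _) m) →
            map toℕ (toList (V.map (punchIn p) w)) ≡ map (shift (toℕ p)) (map toℕ (toList w))
  shifted [] = refl
  shifted (x ∷ w) = cong₂ _∷_ (toℕ-punchIn p x) (shifted w)

restrict-inverse-low : ∀ {n} (p : Fin (suc n)) (τ : Vec (Fin n) n) k → k ≤ toℕ p →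
                       restrict k (word (insertMaxInverse p τ)) ≡ map (shift (toℕ p)) (restrict k (word τ))
restrict-inverse-low p τ k k≤p = begin
  restrict k (word (insertMaxInverse p τ))     ≡⟨ cong (restrict k) (word-insertMaxInverse p τ) ⟩
  restrict k (map (shift (toℕ p)) (word τ) ++ toℕ p ∷ [])
    ≡⟨ LP.filter-++ (_<? k) (map (shift (toℕ p)) (word τ)) (toℕ p ∷ []) ⟩
  restrict k (map (shift (toℕ p)) (word τ)) ++ restrict k (toℕ p ∷ [])
    ≡⟨ cong₂ _++_ (filter-map (_<? k) (_<? k) (shift (toℕ p)) same-side (word τ))
                  (LP.filter-reject (_<? k) (ℕP.≤⇒≯ k≤p)) ⟩
  map (shift (toℕ p)) (restrict k (word τ)) ++ []  ≡⟨ LP.++-identityʳ _ ⟩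
  map (shift (toℕ p)) (restrict k (word τ))        ∎
  where
  open ≡-Reasoning
  same-side : ∀ x → shift (toℕ p) x < k ⇔ x < k
  same-side x with x <? toℕ p
  ... | yes _ = mk⇔ (λ lt → lt) (λ lt → lt)
  ... | no x≮p = mk⇔ (ℕP.<-trans (ℕP.n<1+n x)) (λ x<k → ⊥-elim (x≮p (ℕP.<-≤-trans x<k k≤p)))

restrict-inverse-high : ∀ {n} (p : Fin (suc n)) (τ : Vec (Fin n) n) j → toℕ p ≤ j →
                        restrict (suc j) (word (insertMaxInverse p τ)) ≡
                        map (shift (toℕ p)) (restrict j (word τ)) ++ toℕ p ∷ []
restrict-inverse-high p τ j p≤j = begin
  restrict (suc j) (word (insertMaxInverse p τ))  ≡⟨ cong (restrict (suc j)) (word-insertMaxInverse p τ) ⟩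
  restrict (suc j) (map (shift (toℕ p)) (word τ) ++ toℕ p ∷ [])
    ≡⟨ LP.filter-++ (_<? suc j) (map (shift (toℕ p)) (word τ)) (toℕ p ∷ []) ⟩
  restrict (suc j) (map (shift (toℕ p)) (word τ)) ++ restrict (suc j) (toℕ p ∷ [])
    ≡⟨ cong₂ _++_ (filter-map (_<? suc j) (_<? j) (shift (toℕ p)) same-side (word τ))
                  (LP.filter-accept (_<? suc j) (s≤s p≤j)) ⟩
  map (shift (toℕ p)) (restrict j (word τ)) ++ toℕ p ∷ []  ∎
  where
  open ≡-Reasoning
  same-side : ∀ x → shift (toℕ p) x < suc j ⇔ x < j
  same-side x with x <? toℕ p
  ... | yes x<p = mk⇔ (λ _ → ℕP.<-≤-trans x<p p≤j) (λ _ → s≤s (ℕP.<⇒≤ (ℕP.<-≤-trans x<p p≤j)))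
  ... | no _ = mk⇔ ℕP.≤-pred s≤s

simsunInverse-removeMax : ∀ {n} (p : Fin (suc n)) (τ : Vec (Fin n) n) →
                          Simsun (insertMaxInverse p τ) → Simsun τ
simsunInverse-removeMax p τ simsun' j with j ≤? toℕ p
... | yes j≤p = Equivalence.to (noDoubleDescent-shift (toℕ p) _)
      (subst NoDoubleDescent (restrict-inverse-low p τ j j≤p) (simsun' j))
... | no j≰p = Equivalence.to (noDoubleDescent-shift (toℕ p) _) (noDoubleDescent-prefix _ (toℕ p ∷ [])
      (subst NoDoubleDescent (restrict-inverse-high p τ j (ℕP.<⇒≤ (ℕP.≰⇒> j≰p))) (simsun' (suc j))))

drs123-removeMax : ∀ {n} (σ' : Vec (Fin (suc n)) (suc n)) → DRS (suc n) p123 σ' →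
                   Σ (Fin (suc n)) λ p → Σ (Vec (Fin n) n) λ σ → DRS n p123 σ × insertMax p σ ≡ σ'
drs123-removeMax σ' (σ'-perm , avoids' , simsun' , τ' , τ'-inv , simsunτ') with removeMax σ' σ'-perm
... | p , σ , σ-perm , refl =
  p , σ , (σ-perm , avoids , simsun-removeMax p σ simsun' , τ , inverse-isInverse σ σ-perm , simsunτ) , refl
  where
  τ = inverse σ σ-perm
  avoids : Avoids σ p123
  avoids = avoids' ∘ Equivalence.from (pattern123⇔ (insertMax p σ))
                   ∘ pattern123-insert p σ ∘ Equivalence.to (pattern123⇔ σ)
  τ'≡ : τ' ≡ insertMaxInverse p τ
  τ'≡ = inverse-unique (insertMax p σ) τ' (insertMaxInverse p τ) σ'-perm τ'-inv
          (insertMaxInverse-isInverse p σ τ (inverse-isInverse σ σ-perm))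
  simsunτ : Simsun τ
  simsunτ = simsunInverse-removeMax p τ (subst Simsun τ'≡ simsunτ')

pattern123? : ∀ {n} (σ : Vec (Fin n) n) → Dec (Pattern123 σ)
pattern123? σ = FP.any? λ i → FP.any? λ j → FP.any? λ k →
  (i FP.<? j) ×-dec (j FP.<? k) ×-dec (lookup σ i FP.<? lookup σ j) ×-dec (lookup σ j FP.<? lookup σ k)

avoids123? : ∀ {n} (σ : Vec (Fin n) n) → Dec (Avoids σ p123)
avoids123? σ = map′ (λ no123 → no123 ∘ Equivalence.to (pattern123⇔ σ))
                    (λ avoids → avoids ∘ Equivalence.from (pattern123⇔ σ)) (¬? (pattern123? σ))

noDoubleDescent? : (l : List ℕ) → Dec (NoDoubleDescent l)
noDoubleDescent? [] = yes tt
noDoubleDescent? (a ∷ []) = yes tt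
noDoubleDescent? (a ∷ b ∷ []) = yes tt
noDoubleDescent? (a ∷ b ∷ c ∷ r) with (b <? a) ×-dec (c <? b) | noDoubleDescent? (b ∷ c ∷ r)
... | yes descent | _ = no (λ ok → proj₁ ok descent)
... | no no-descent | yes rest = yes (no-descent , rest)
... | no _ | no bad-rest = no (bad-rest ∘ proj₂)

simsun? : ∀ {n} (σ : Vec (Fin n) n) → Dec (Simsun σ)
simsun? {n} σ = map′ from-bounded (λ simsun k → simsun (toℕ k))
                     (FP.all? (λ (k : Fin (suc n)) → noDoubleDescent? (restrict (toℕ k) (word σ))))
  where
  from-bounded : (∀ (k : Fin (suc n)) → NoDoubleDescent (restrict (toℕ k) (word σ))) → Simsun σ
  from-bounded bounded = simsun-upTo σ (λ k k≤n → subst (λ z → NoDoubleDescent (restrict z (word σ)))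
                                                  (FP.toℕ-fromℕ< (s≤s k≤n)) (bounded (fromℕ< (s≤s k≤n))))

isPerm? : ∀ {n} (σ : Vec (Fin n) n) → Dec (IsPerm σ)
isPerm? σ = FP.all? λ i → FP.all? λ j → (lookup σ i FP.≟ lookup σ j) →-dec (i FP.≟ j)

drs123? : ∀ {n} (σ : Vec (Fin n) n) → Dec (DRS n p123 σ)
drs123? {n} σ with isPerm? σ
... | no not-perm = no (not-perm ∘ proj₁)
... | yes σ-perm = map′ assemble disassemble (avoids123? σ ×-dec simsun? σ ×-dec simsun? (inverse σ σ-perm))
  where
  assemble : Avoids σ p123 × Simsun σ × Simsun (inverse σ σ-perm) → DRS n p123 σ
  assemble (avoids , simsun , simsun⁻¹) =
    σ-perm , avoids , simsun , inverse σ σ-perm , inverse-isInverse σ σ-perm , simsun⁻¹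
  disassemble : DRS n p123 σ → Avoids σ p123 × Simsun σ × Simsun (inverse σ σ-perm)
  disassemble (_ , avoids , simsun , τ , τ-inv , simsunτ) =
    avoids , simsun ,
    subst Simsun (inverse-unique σ τ (inverse σ σ-perm) σ-perm τ-inv (inverse-isInverse σ σ-perm)) simsunτ

insertions : ∀ {n} → List (Vec (Fin n) n) → List (Vec (Fin (suc n)) (suc n))
insertions [] = []
insertions {n} (σ ∷ σs) = map (λ p → insertMax p σ) (allFin (suc n)) ++ insertions σs

insertions⁺ : ∀ {n} (σs : List (Vec (Fin n) n)) σ p → σ ∈ σs → insertMax p σ ∈ insertions σs
insertions⁺ (σ ∷ σs) σ p (here refl) = ∈-++⁺ˡ (∈-map⁺ (λ q → insertMax q σ) (∈-allFin p))
insertions⁺ (τ ∷ σs) σ p (there σ∈) = ∈-++⁺ʳ _ (insertions⁺ σs σ p σ∈)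

insertions⁻ : ∀ {n} (σs : List (Vec (Fin n) n)) σ' → σ' ∈ insertions σs →
              ∃ λ σ → σ ∈ σs × ∃ λ p → σ' ≡ insertMax p σ
insertions⁻ (σ ∷ σs) σ' σ'∈ with ∈-++⁻ (map (λ p → insertMax p σ) (allFin _)) σ'∈
... | inj₁ here′ with ∈-map⁻ (λ p → insertMax p σ) {xs = allFin _} here′
...   | p , _ , eq = σ , here refl , p , eq
insertions⁻ (σ ∷ σs) σ' σ'∈ | inj₂ later with insertions⁻ σs σ' later
...   | τ , τ∈ , p , eq = τ , there τ∈ , p , eq

insertions-unique : ∀ {n} (σs : List (Vec (Fin n) n)) → Unique σs → Unique (insertions σs)
insertions-unique [] _ = []
insertions-unique {n} (σ ∷ σs) (σ-new ∷ σs-unique) =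
  UniqueP.++⁺ (UniqueP.map⁺ (λ eq → proj₁ (insertMax-injective _ _ σ σ eq)) (UniqueP.allFin⁺ (suc n)))
              (insertions-unique σs σs-unique) disjoint
  where
  disjoint : ∀ {σ'} → ¬ (σ' ∈ map (λ p → insertMax p σ) (allFin (suc n)) × σ' ∈ insertions σs)
  disjoint {σ'} (σ'∈ , σ'∈′)
    with ∈-map⁻ (λ p → insertMax p σ) {xs = allFin (suc n)} σ'∈ | insertions⁻ σs σ' σ'∈′
  ... | p , _ , refl | τ , τ∈ , q , eq = All.lookup σ-new τ∈ (proj₂ (insertMax-injective _ _ _ _ eq))

drs123-level : (n : ℕ) → List (Vec (Fin n) n)
drs123-level zero = [] ∷ []
drs123-level (suc n) = filter drs123? (insertions (drs123-level n))

drs123-level-unique : ∀ n → Unique (drs123-level n)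
drs123-level-unique zero = [] ∷ []
drs123-level-unique (suc n) = UniqueP.filter⁺ drs123? (insertions-unique (drs123-level n) (drs123-level-unique n))

-- The list is correct because DRS(123) is closed under deleting the maximum.
drs123-level-members : ∀ n (σ : Vec (Fin n) n) → (σ ∈ drs123-level n) ⇔ DRS n p123 σ
drs123-level-members zero [] = mk⇔ (λ _ → toWitness {a? = drs123? {0} []} tt) (λ _ → here refl)
drs123-level-members (suc n) σ' = mk⇔ (proj₂ ∘ ∈-filter⁻ drs123? {xs = insertions (drs123-level n)}) from-drs
  where
  from-drs : DRS (suc n) p123 σ' → σ' ∈ drs123-level (suc n)
  from-drs drs with drs123-removeMax σ' drs
  ... | p , σ , drsσ , refl = ∈-filter⁺ drs123?
        (insertions⁺ (drs123-level n) σ p (Equivalence.from (drs123-level-members n σ) drsσ)) drs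

drs123-count : ∀ n → HasCard (DRS n p123) (length (drs123-level n))
drs123-count n = drs123-level n , drs123-level-unique n , drs123-level-members n , refl

-- A₆ = 563412 and B₆ = 645231 (written 0-based below) are involutions;
-- A(m+1) inserts a new maximum into B m at position 1, B(m+1) into A m at position 0, and
-- A⁻¹, B⁻¹ are the corresponding inverses built with `insertMaxInverse`.
A₆ B₆ : Vec (Fin 6) 6
A₆ = # 4 ∷ # 5 ∷ # 2 ∷ # 3 ∷ # 0 ∷ # 1 ∷ []
B₆ = # 5 ∷ # 3 ∷ # 4 ∷ # 1 ∷ # 2 ∷ # 0 ∷ []

A B A⁻¹ B⁻¹ : (m : ℕ) → Vec (Fin (6 + m)) (6 + m)
A zero = A₆
A (suc m) = insertMax (# 1) (B m)
B zero = B₆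
B (suc m) = insertMax (# 0) (A m)
A⁻¹ zero = A₆
A⁻¹ (suc m) = insertMaxInverse (# 1) (B⁻¹ m)
B⁻¹ zero = B₆
B⁻¹ (suc m) = insertMaxInverse (# 0) (A⁻¹ m)

record Prefix {n} (σ : Vec (Fin (4 + n)) (4 + n)) (v₀ v₁ v₂ v₃ : ℕ) : Set where
  field
    at₀ : value σ (# 0) ≡ v₀
    at₁ : value σ (# 1) ≡ v₁
    at₂ : value σ (# 2) ≡ v₂
    at₃ : value σ (# 3) ≡ v₃

A-prefix : ∀ m → Prefix (A m) (4 + m) (5 + m) (2 + m) (3 + m)
B-prefix : ∀ m → Prefix (B m) (5 + m) (3 + m) (4 + m) (1 + m)
A-prefix zero = record { at₀ = refl ; at₁ = refl ; at₂ = refl ; at₃ = refl }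
A-prefix (suc m) = record
  { at₀ = trans (value-old (# 1) (B m) (# 0)) (Prefix.at₀ (B-prefix m))
  ; at₁ = value-max (# 1) (B m)
  ; at₂ = trans (value-old (# 1) (B m) (# 1)) (Prefix.at₁ (B-prefix m))
  ; at₃ = trans (value-old (# 1) (B m) (# 2)) (Prefix.at₂ (B-prefix m))
  }
B-prefix zero = record { at₀ = refl ; at₁ = refl ; at₂ = refl ; at₃ = refl }
B-prefix (suc m) = record
  { at₀ = value-max (# 0) (A m)
  ; at₁ = trans (value-old (# 0) (A m) (# 0)) (Prefix.at₀ (A-prefix m))
  ; at₂ = trans (value-old (# 0) (A m) (# 1)) (Prefix.at₁ (A-prefix m))
  ; at₃ = trans (value-old (# 0) (A m) (# 2)) (Prefix.at₂ (A-prefix m))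
  }

shifted< : ∀ m {a b} → a < b → a + m < b + m
shifted< m = ℕP.+-monoˡ-< m

A≢B : ∀ m → A m ≢ B m
A≢B m eq = ℕP.<-irrefl (trans (sym (Prefix.at₀ (A-prefix m)))
  (trans (cong (λ σ → value σ (# 0)) eq) (Prefix.at₀ (B-prefix m))))
  (shifted< m {4} (s≤s (s≤s (s≤s (s≤s (s≤s z≤n))))))

noDoubleDescent-word : ∀ {n} (σ : Vec (Fin n) n) → Simsun σ → NoDoubleDescent (word σ)
noDoubleDescent-word {n} σ simsun = subst NoDoubleDescent (restrict-whole σ n ℕP.≤-refl) (simsun n)

word-insertMax₀ : ∀ {n} (σ : Vec (Fin n) n) → word (insertMax (# 0) σ) ≡ n ∷ word σ
word-insertMax₀ {n} σ = cong₂ _∷_ (FP.toℕ-fromℕ n) (word-inject₁ σ)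

word-insertMax₁ : ∀ {n} (x : Fin (suc n)) (w : Vec (Fin (suc n)) n) →
                  word (insertMax (# 1) (x ∷ w)) ≡ toℕ x ∷ suc n ∷ map toℕ (toList w)
word-insertMax₁ {n} x w =
  cong₂ _∷_ (FP.toℕ-inject₁ x) (cong₂ _∷_ (FP.toℕ-fromℕ (suc n)) (word-inject₁ w))

word-insertMax₂ : ∀ {n} (x y : Fin (suc (suc n))) (w : Vec (Fin (suc (suc n))) n) →
                  word (insertMax (# 2) (x ∷ y ∷ w)) ≡ toℕ x ∷ toℕ y ∷ suc (suc n) ∷ map toℕ (toList w)
word-insertMax₂ {n} x y w = cong₂ _∷_ (FP.toℕ-inject₁ x)
  (cong₂ _∷_ (FP.toℕ-inject₁ y) (cong₂ _∷_ (FP.toℕ-fromℕ (suc (suc n))) (word-inject₁ w)))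

-- The maximum placed just before a descent creates a double descent.
descent-after-max₀ : ∀ {n} (σ : Vec (Fin (suc (suc n))) (suc (suc n))) →
                     value σ (# 1) < value σ (# 0) → ¬ Simsun (insertMax (# 0) σ)
descent-after-max₀ (x ∷ y ∷ w) y<x simsun =
  proj₁ (subst NoDoubleDescent (word-insertMax₀ (x ∷ y ∷ w)) (noDoubleDescent-word _ simsun)) (FP.toℕ<n x , y<x)

descent-after-max₁ : ∀ {n} (σ : Vec (Fin (suc (suc (suc n)))) (suc (suc (suc n)))) →
                     value σ (# 2) < value σ (# 1) → ¬ Simsun (insertMax (# 1) σ)
descent-after-max₁ (x ∷ y ∷ z ∷ w) z<y simsun =
  proj₁ (proj₂ (subst NoDoubleDescent (word-insertMax₁ x (y ∷ z ∷ w)) (noDoubleDescent-word _ simsun)))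
        (FP.toℕ<n y , z<y)

descent-after-max₂ : ∀ {n} (σ : Vec (Fin (suc (suc (suc (suc n))))) (suc (suc (suc (suc n))))) →
                     value σ (# 3) < value σ (# 2) → ¬ Simsun (insertMax (# 2) σ)
descent-after-max₂ (x ∷ y ∷ z ∷ u ∷ w) u<z simsun =
  proj₁ (proj₂ (proj₂ (subst NoDoubleDescent (word-insertMax₂ x y (z ∷ u ∷ w)) (noDoubleDescent-word _ simsun))))
        (FP.toℕ<n z , u<z)

ascent-before-max : ∀ {n} (p : Fin (suc n)) (σ : Vec (Fin n) n) (i j : Fin n) →
                    toℕ i < toℕ j → toℕ j < toℕ p → value σ i < value σ j → Pattern123 (insertMax p σ)
ascent-before-max p σ i j i<j j<p σi<σj =
  punchIn p i , punchIn p j , p ,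
  subst₂ _<_ (sym (punchIn-left p i (ℕP.<-trans i<j j<p))) (sym (punchIn-left p j j<p)) i<j ,
  subst (_< toℕ p) (sym (punchIn-left p j j<p)) j<p ,
  Equivalence.to (old-order p σ i j) σi<σj , old-below-max p σ j

FamilyMember : ∀ m → Vec (Fin (6 + m)) (6 + m) → Set
FamilyMember m σ = σ ≡ A m ⊎ σ ≡ B m

-- Extending A m by its new maximum N (letters 0-based): position 0 gives B(m+1), position 1
-- the double descent N > 5+m > 2+m, later positions the 123 (4+m, 5+m, N).
extend-A : ∀ m (p : Fin (7 + m)) → Avoids (insertMax p (A m)) p123 → Simsun (insertMax p (A m)) →
           FamilyMember (suc m) (insertMax p (A m))
extend-A m fzero _ _ = inj₂ refl
extend-A m (fsuc fzero) _ simsun = ⊥-elim (descent-after-max₁ (A m)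
  (subst₂ _<_ (sym (Prefix.at₂ (A-prefix m))) (sym (Prefix.at₁ (A-prefix m)))
          (shifted< m {2} (s≤s (s≤s (s≤s z≤n))))) simsun)
extend-A m (fsuc (fsuc q)) avoids _ = ⊥-elim (avoids (Equivalence.from (pattern123⇔ (insertMax (fsuc (fsuc q)) (A m)))
  (ascent-before-max (fsuc (fsuc q)) (A m) (# 0) (# 1) (s≤s z≤n) (s≤s (s≤s z≤n))
    (subst₂ _<_ (sym (Prefix.at₀ (A-prefix m))) (sym (Prefix.at₁ (A-prefix m)))
            (shifted< m {4} (s≤s (s≤s (s≤s (s≤s (s≤s z≤n))))))))))

-- Extending B m: position 1 gives A(m+1), positions 0 and 2 the double descents
-- N > 5+m > 3+m and N > 4+m > 1+m, later positions the 123 (3+m, 4+m, N).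
extend-B : ∀ m (p : Fin (7 + m)) → Avoids (insertMax p (B m)) p123 → Simsun (insertMax p (B m)) →
           FamilyMember (suc m) (insertMax p (B m))
extend-B m fzero _ simsun = ⊥-elim (descent-after-max₀ (B m)
  (subst₂ _<_ (sym (Prefix.at₁ (B-prefix m))) (sym (Prefix.at₀ (B-prefix m)))
          (shifted< m {3} (s≤s (s≤s (s≤s (s≤s z≤n)))))) simsun)
extend-B m (fsuc fzero) _ _ = inj₁ refl
extend-B m (fsuc (fsuc fzero)) _ simsun = ⊥-elim (descent-after-max₂ (B m)
  (subst₂ _<_ (sym (Prefix.at₃ (B-prefix m))) (sym (Prefix.at₂ (B-prefix m)))
          (shifted< m {1} (s≤s (s≤s z≤n)))) simsun)
extend-B m (fsuc (fsuc (fsuc q))) avoids _ =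
  ⊥-elim (avoids (Equivalence.from (pattern123⇔ (insertMax (fsuc (fsuc (fsuc q))) (B m)))
  (ascent-before-max (fsuc (fsuc (fsuc q))) (B m) (# 1) (# 2) (s≤s (s≤s z≤n)) (s≤s (s≤s (s≤s z≤n)))
    (subst₂ _<_ (sym (Prefix.at₁ (B-prefix m))) (sym (Prefix.at₂ (B-prefix m)))
            (shifted< m {3} (s≤s (s≤s (s≤s (s≤s z≤n)))))))))

extend-family : ∀ m (p : Fin (7 + m)) σ → FamilyMember m σ → DRS (7 + m) p123 (insertMax p σ) →
                FamilyMember (suc m) (insertMax p σ)
extend-family m p σ (inj₁ refl) (_ , avoids , simsun , _) = extend-A m p avoids simsun
extend-family m p σ (inj₂ refl) (_ , avoids , simsun , _) = extend-B m p avoids simsun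

drs123-level-6 : drs123-level 6 ≡ B₆ ∷ A₆ ∷ []
drs123-level-6 = refl

drs123-classify : ∀ m (σ : Vec (Fin (6 + m)) (6 + m)) → DRS (6 + m) p123 σ → FamilyMember m σ
drs123-classify zero σ drs =
  listed (subst (σ ∈_) drs123-level-6 (Equivalence.from (drs123-level-members 6 σ) drs))
  where
  listed : σ ∈ B₆ ∷ A₆ ∷ [] → FamilyMember 0 σ
  listed (here σ≡B₆) = inj₂ σ≡B₆
  listed (there (here σ≡A₆)) = inj₁ σ≡A₆
drs123-classify (suc m) σ' drs = from-parent (drs123-removeMax σ' drs)
  where
  from-parent : (Σ (Fin (7 + m)) λ p → Σ (Vec (Fin (6 + m)) (6 + m)) λ σ →
                   DRS (6 + m) p123 σ × insertMax p σ ≡ σ') → FamilyMember (suc m) σ'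
  from-parent (p , σ , drsσ , eq) = subst (FamilyMember (suc m)) eq
    (extend-family m p σ (drs123-classify m σ drsσ) (subst (DRS (7 + m) p123) (sym eq) drs))

-- A maximum inserted at position 0 or 1 can only be the last letter of a 123, which is
-- impossible that early; so 123-avoidance is preserved.
avoids123-insertMax-front : ∀ {n} (p : Fin (suc n)) (σ : Vec (Fin n) n) → toℕ p ≤ 1 →
                            Avoids σ p123 → Avoids (insertMax p σ) p123
avoids123-insertMax-front p σ p≤1 avoids contains
  with Equivalence.to (pattern123⇔ (insertMax p σ)) contains
... | i' , j' , k' , i'<j' , j'<k' , σi'<σj' , σj'<σk'
  with position-split p i' | position-split p j' | position-split p k'
... | inj₁ refl | _ | _ = max-not-below p σ j' σi'<σj'
... | inj₂ _ | inj₁ refl | _ = max-not-below p σ k' σj'<σk'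
... | inj₂ _ | inj₂ _ | inj₁ refl =
  ℕP.<⇒≱ (ℕP.<-≤-trans i'<j' (ℕP.≤-pred (ℕP.<-≤-trans j'<k' p≤1))) z≤n
... | inj₂ (i , refl) | inj₂ (j , refl) | inj₂ (k , refl) = avoids (Equivalence.from (pattern123⇔ σ)
      (i , j , k , punchIn-cancel p i j i'<j' , punchIn-cancel p j k j'<k' ,
       Equivalence.from (old-order p σ i j) σi'<σj' , Equivalence.from (old-order p σ j k) σj'<σk'))

noDoubleDescent-insertMax₀ : ∀ {n} (σ : Vec (Fin (suc (suc n))) (suc (suc n))) →
  value σ (# 0) < value σ (# 1) → Simsun σ → NoDoubleDescent (word (insertMax (# 0) σ))
noDoubleDescent-insertMax₀ (x ∷ y ∷ w) x<y simsun = subst NoDoubleDescent (sym (word-insertMax₀ (x ∷ y ∷ w)))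
  ((λ { (_ , y<x) → ℕP.<-asym x<y y<x }) , noDoubleDescent-word _ simsun)

noDoubleDescent-insertMax₁ : ∀ {n} (σ : Vec (Fin (suc (suc (suc n)))) (suc (suc (suc n)))) →
  value σ (# 1) < value σ (# 2) → Simsun σ → NoDoubleDescent (word (insertMax (# 1) σ))
noDoubleDescent-insertMax₁ (x ∷ y ∷ z ∷ w) y<z simsun =
  subst NoDoubleDescent (sym (word-insertMax₁ x (y ∷ z ∷ w)))
  ((λ { (max<x , _) → ℕP.<-asym (FP.toℕ<n x) max<x }) , (λ { (_ , z<y) → ℕP.<-asym y<z z<y }) ,
   proj₂ (noDoubleDescent-word _ simsun))

noDoubleDescent-after-ascent₁ : ∀ X a b → NoDoubleDescent (X ++ a ∷ []) → a ≤ b →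
                                NoDoubleDescent (X ++ a ∷ b ∷ [])
noDoubleDescent-after-ascent₁ [] a b _ _ = tt
noDoubleDescent-after-ascent₁ (x ∷ []) a b _ a≤b = (λ { (_ , b<a) → ℕP.<⇒≱ b<a a≤b }) , tt
noDoubleDescent-after-ascent₁ (x ∷ y ∷ []) a b (ok , rest) a≤b =
  ok , noDoubleDescent-after-ascent₁ (y ∷ []) a b rest a≤b
noDoubleDescent-after-ascent₁ (x ∷ y ∷ z ∷ X) a b (ok , rest) a≤b =
  ok , noDoubleDescent-after-ascent₁ (y ∷ z ∷ X) a b rest a≤b

noDoubleDescent-after-ascent₂ : ∀ X a b c → NoDoubleDescent (X ++ a ∷ b ∷ []) → a ≤ b →
                                NoDoubleDescent (X ++ a ∷ b ∷ c ∷ [])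
noDoubleDescent-after-ascent₂ [] a b c _ a≤b = (λ { (b<a , _) → ℕP.<⇒≱ b<a a≤b }) , tt
noDoubleDescent-after-ascent₂ (x ∷ []) a b c (ok , rest) a≤b = ok , noDoubleDescent-after-ascent₂ [] a b c rest a≤b
noDoubleDescent-after-ascent₂ (x ∷ y ∷ []) a b c (ok , rest) a≤b =
  ok , noDoubleDescent-after-ascent₂ (y ∷ []) a b c rest a≤b
noDoubleDescent-after-ascent₂ (x ∷ y ∷ z ∷ X) a b c (ok , rest) a≤b =
  ok , noDoubleDescent-after-ascent₂ (y ∷ z ∷ X) a b c rest a≤b

restrict-above : ∀ j M → All (j ≤_) M → restrict j M ≡ []
restrict-above j M above = LP.filter-none (_<? j) (All.map (λ j≤x x<j → ℕP.<⇒≱ x<j j≤x) above)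

-- Shapes of the inverse words: A⁻¹ ends with the letters 0 1, B⁻¹ with 0, preceded by larger letters.
EndsWith01 EndsWith0 : ∀ {n} → Vec (Fin n) n → Set
EndsWith01 τ = Σ (List ℕ) λ M → word τ ≡ M ++ 0 ∷ 1 ∷ [] × All (2 ≤_) M
EndsWith0 τ = Σ (List ℕ) λ M → word τ ≡ M ++ 0 ∷ [] × All (1 ≤_) M

simsun-insertMaxInverse-low : ∀ {n} (p : Fin (suc n)) (τ : Vec (Fin n) n) → Simsun τ → ∀ k → k ≤ toℕ p →
                              NoDoubleDescent (restrict k (word (insertMaxInverse p τ)))
simsun-insertMaxInverse-low p τ simsun k k≤p = subst NoDoubleDescent (sym (restrict-inverse-low p τ k k≤p))
  (Equivalence.from (noDoubleDescent-shift (toℕ p) _) (simsun k))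

-- Inserting 0 into an inverse ending in 0 1: the new word ends in 1 2 0.
simsun-insertMaxInverse₀ : ∀ {n} (τ : Vec (Fin n) n) → Simsun τ → EndsWith01 τ →
                           Simsun (insertMaxInverse (# 0) τ)
simsun-insertMaxInverse₀ τ simsun (M , τ≡ , M-large) zero = simsun-insertMaxInverse-low (# 0) τ simsun zero z≤n
simsun-insertMaxInverse₀ τ simsun (M , τ≡ , M-large) (suc j) =
  subst NoDoubleDescent (sym (restrict-inverse-high (# 0) τ j z≤n)) (restricted j)
  where
  split-restrict : ∀ j → restrict j (word τ) ≡ restrict j M ++ restrict j (0 ∷ 1 ∷ [])
  split-restrict j = trans (cong (restrict j) τ≡) (LP.filter-++ (_<? j) M (0 ∷ 1 ∷ []))
  restricted : ∀ j → NoDoubleDescent (map (shift 0) (restrict j (word τ)) ++ 0 ∷ [])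
  restricted zero rewrite split-restrict zero | restrict-above 0 M (All.map (λ _ → z≤n) M-large) = tt
  restricted (suc zero) rewrite split-restrict 1 | restrict-above 1 M (All.map (ℕP.≤-trans (s≤s z≤n)) M-large) = tt
  restricted (suc (suc j)) = subst NoDoubleDescent (sym reshape)
    (noDoubleDescent-after-ascent₂ (map (shift 0) R) 1 2 0 prefix-ok (s≤s z≤n))
    where
    R = restrict (suc (suc j)) M
    reshape : map (shift 0) (restrict (suc (suc j)) (word τ)) ++ 0 ∷ [] ≡ map (shift 0) R ++ 1 ∷ 2 ∷ 0 ∷ []
    reshape = trans (cong (λ z → map (shift 0) z ++ 0 ∷ []) (split-restrict (suc (suc j))))
      (trans (cong (_++ 0 ∷ []) (LP.map-++ (shift 0) R (0 ∷ 1 ∷ [])))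
             (LP.++-assoc (map (shift 0) R) (1 ∷ 2 ∷ []) (0 ∷ [])))
    prefix-ok : NoDoubleDescent (map (shift 0) R ++ 1 ∷ 2 ∷ [])
    prefix-ok = subst NoDoubleDescent
      (trans (cong (map (shift 0)) (split-restrict (suc (suc j)))) (LP.map-++ (shift 0) R (0 ∷ 1 ∷ [])))
      (Equivalence.from (noDoubleDescent-shift 0 _) (simsun (suc (suc j))))

-- Inserting 1 into an inverse ending in 0: the new word ends in 0 1.
simsun-insertMaxInverse₁ : ∀ {n} (τ : Vec (Fin (suc n)) (suc n)) → Simsun τ → EndsWith0 τ →
                           Simsun (insertMaxInverse (# 1) τ)
simsun-insertMaxInverse₁ τ simsun _ zero = simsun-insertMaxInverse-low (# 1) τ simsun zero z≤n
simsun-insertMaxInverse₁ τ simsun _ (suc zero) = simsun-insertMaxInverse-low (# 1) τ simsun 1 ℕP.≤-refl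
simsun-insertMaxInverse₁ τ simsun (M , τ≡ , _) (suc (suc j)) =
  subst NoDoubleDescent (sym (trans (restrict-inverse-high (# 1) τ (suc j) (s≤s z≤n)) reshape))
    (noDoubleDescent-after-ascent₁ (map (shift 1) R) 0 1 prefix-ok z≤n)
  where
  R = restrict (suc j) M
  split-restrict : restrict (suc j) (word τ) ≡ R ++ 0 ∷ []
  split-restrict = trans (cong (restrict (suc j)) τ≡) (LP.filter-++ (_<? suc j) M (0 ∷ []))
  reshape : map (shift 1) (restrict (suc j) (word τ)) ++ 1 ∷ [] ≡ map (shift 1) R ++ 0 ∷ 1 ∷ []
  reshape = trans (cong (λ z → map (shift 1) z ++ 1 ∷ []) split-restrict)
    (trans (cong (_++ 1 ∷ []) (LP.map-++ (shift 1) R (0 ∷ []))) (LP.++-assoc (map (shift 1) R) (0 ∷ []) (1 ∷ [])))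
  prefix-ok : NoDoubleDescent (map (shift 1) R ++ 0 ∷ [])
  prefix-ok = subst NoDoubleDescent (trans (cong (map (shift 1)) split-restrict) (LP.map-++ (shift 1) R (0 ∷ [])))
    (Equivalence.from (noDoubleDescent-shift 1 _) (simsun (suc j)))

endsWith0-step : ∀ {n} (τ : Vec (Fin n) n) → EndsWith01 τ → EndsWith0 (insertMaxInverse (# 0) τ)
endsWith0-step τ (M , τ≡ , M-large) = map (shift 0) M ++ 1 ∷ 2 ∷ [] ,
  trans (word-insertMaxInverse (# 0) τ) (trans (cong (λ z → map (shift 0) z ++ 0 ∷ []) τ≡)
    (cong (_++ 0 ∷ []) (LP.map-++ (shift 0) M (0 ∷ 1 ∷ [])))) ,
  AllP.++⁺ (AllP.map⁺ (All.map (λ {x} _ → subst (1 ≤_) (sym (shift-above {0} {x} z≤n)) (s≤s z≤n)) M-large))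
           (s≤s z≤n ∷ s≤s z≤n ∷ [])

endsWith01-step : ∀ {n} (τ : Vec (Fin (suc n)) (suc n)) → EndsWith0 τ → EndsWith01 (insertMaxInverse (# 1) τ)
endsWith01-step τ (M , τ≡ , M-large) = map (shift 1) M ,
  trans (word-insertMaxInverse (# 1) τ) (trans (cong (λ z → map (shift 1) z ++ 1 ∷ []) τ≡)
    (trans (cong (_++ 1 ∷ []) (LP.map-++ (shift 1) M (0 ∷ []))) (LP.++-assoc (map (shift 1) M) (0 ∷ []) (1 ∷ [])))) ,
  AllP.map⁺ (All.map (λ {x} 1≤x → subst (2 ≤_) (sym (shift-above {1} {x} 1≤x)) (s≤s 1≤x)) M-large)

MemberWith : ∀ {n} → Vec (Fin n) n → Vec (Fin n) n → (Vec (Fin n) n → Set) → Set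
MemberWith σ τ Shape = IsPerm σ × Avoids σ p123 × Simsun σ × IsInverse τ σ × Simsun τ × Shape τ

A-member : ∀ m → MemberWith (A m) (A⁻¹ m) EndsWith01
B-member : ∀ m → MemberWith (B m) (B⁻¹ m) EndsWith0
A-member zero =
  toWitness {a? = isPerm? A₆} tt , toWitness {a? = avoids123? A₆} tt , toWitness {a? = simsun? A₆} tt ,
  toWitness {a? = FP.all? (λ i → lookup A₆ (lookup A₆ i) FP.≟ i)} tt , toWitness {a? = simsun? A₆} tt ,
  (4 ∷ 5 ∷ 2 ∷ 3 ∷ [] , refl , s≤s (s≤s z≤n) ∷ s≤s (s≤s z≤n) ∷ s≤s (s≤s z≤n) ∷ s≤s (s≤s z≤n) ∷ [])
A-member (suc m) with B-member m
... | σ-perm , avoids , simsun , τσ≡id , simsunτ , shape =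
  insertMax-perm (# 1) (B m) σ-perm , avoids123-insertMax-front (# 1) (B m) (s≤s z≤n) avoids ,
  simsun-insertMax (# 1) (B m) simsun (noDoubleDescent-insertMax₁ (B m)
    (subst₂ _<_ (sym (Prefix.at₁ (B-prefix m))) (sym (Prefix.at₂ (B-prefix m)))
                (shifted< m {3} (s≤s (s≤s (s≤s (s≤s z≤n)))))) simsun) ,
  insertMaxInverse-isInverse (# 1) (B m) (B⁻¹ m) τσ≡id , simsun-insertMaxInverse₁ (B⁻¹ m) simsunτ shape ,
  endsWith01-step (B⁻¹ m) shape
B-member zero =
  toWitness {a? = isPerm? B₆} tt , toWitness {a? = avoids123? B₆} tt , toWitness {a? = simsun? B₆} tt ,
  toWitness {a? = FP.all? (λ i → lookup B₆ (lookup B₆ i) FP.≟ i)} tt , toWitness {a? = simsun? B₆} tt ,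
  (5 ∷ 3 ∷ 4 ∷ 1 ∷ 2 ∷ [] , refl , s≤s z≤n ∷ s≤s z≤n ∷ s≤s z≤n ∷ s≤s z≤n ∷ s≤s z≤n ∷ [])
B-member (suc m) with A-member m
... | σ-perm , avoids , simsun , τσ≡id , simsunτ , shape =
  insertMax-perm (# 0) (A m) σ-perm , avoids123-insertMax-front (# 0) (A m) z≤n avoids ,
  simsun-insertMax (# 0) (A m) simsun (noDoubleDescent-insertMax₀ (A m)
    (subst₂ _<_ (sym (Prefix.at₀ (A-prefix m))) (sym (Prefix.at₁ (A-prefix m)))
                (shifted< m {4} (s≤s (s≤s (s≤s (s≤s (s≤s z≤n))))))) simsun) ,
  insertMaxInverse-isInverse (# 0) (A m) (A⁻¹ m) τσ≡id , simsun-insertMaxInverse₀ (A⁻¹ m) simsunτ shape ,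
  endsWith0-step (A⁻¹ m) shape

family-drs : ∀ m σ → FamilyMember m σ → DRS (6 + m) p123 σ
family-drs m σ (inj₁ refl) with A-member m
... | σ-perm , avoids , simsun , τσ≡id , simsunτ , _ = σ-perm , avoids , simsun , A⁻¹ m , τσ≡id , simsunτ
family-drs m σ (inj₂ refl) with B-member m
... | σ-perm , avoids , simsun , τσ≡id , simsunτ , _ = σ-perm , avoids , simsun , B⁻¹ m , τσ≡id , simsunτ

drs123-large : ∀ m → HasCard (DRS (6 + m) p123) 2
drs123-large m = A m ∷ B m ∷ [] , (A≢B m ∷ []) ∷ [] ∷ [] , members , refl
  where
  members : ∀ σ → (σ ∈ A m ∷ B m ∷ []) ⇔ DRS (6 + m) p123 σ
  members σ = mk⇔ (family-drs m σ ∘ listed⇒family) (family⇒listed ∘ drs123-classify m σ)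
    where
    listed⇒family : σ ∈ A m ∷ B m ∷ [] → FamilyMember m σ
    listed⇒family (here σ≡A) = inj₁ σ≡A
    listed⇒family (there (here σ≡B)) = inj₂ σ≡B
    family⇒listed : FamilyMember m σ → σ ∈ A m ∷ B m ∷ []
    family⇒listed (inj₁ σ≡A) = here σ≡A
    family⇒listed (inj₂ σ≡B) = there (here σ≡B)

theorem4p11 : (∀ (n : ℕ) → 1 ≤ n → HasCard (DRS n p321) (catalan n))
    × HasCard (DRS 4 p123) 5
    × HasCard (DRS 5 p123) 3
    × (∀ (n : ℕ) → 6 ≤ n → HasCard (DRS n p123) 2)
theorem4p11 = drs321-catalan , drs123-count 4 , drs123-count 5 , drs123-from-6
  where
  drs321-catalan : ∀ n → 1 ≤ n → HasCard (DRS n p321) (catalan n)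
  drs321-catalan (suc r) _ = map proj₁ (level (suc r)) , level-unique (suc r) , level-members (suc r) ,
                             trans (level-length (suc r)) (descendants-catalan r)
  drs123-from-6 : ∀ n → 6 ≤ n → HasCard (DRS n p123) 2
  drs123-from-6 n 6≤n with ℕP.m≤n⇒∃[o]m+o≡n 6≤n
  ... | m , refl = drs123-large m
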